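{- Let $H$ be a hexagonal ring with $n$ hexagons and type $M_1M_2\cdots M_n$, where each $M_i\in\{t(1),t(2),t(3)\}$. Then the number of maximal matchings of $H$ is $$\Psi(H)=\operatorname{tr}\Big(\prod_{i=1}^{n} f(M_i)\Big)=\operatorname{tr}\big(f(M_1)f(M_2)\cdots f(M_n)\big),$$ where $f(t(1))=L$, $f(t(2))=S$, $f(t(3))=R$, and $\operatorname{tr}$ denotes the trace of a matrix.
   Context: A matching of a graph is maximal if it is not contained in any larger matching; $\Psi(X)$ denotes the number of maximal matchings of a graph $X$. A hexagonal ring with $n$ hexagons is a 2-connected plane graph obtained as follows. There are $n$ hexagons (6-cycles) $H_1,\dots,H_n$ (the faces), arranged cyclically: for $i=2,\dots,n$ the hexagons $H_{i-1}$ and $H_i$ share exactly one edge $e_i$, the hexagons $H_n$ and $H_1$ share exactly one edge $e_1$, no other pair of hexagons shares an edge, and every vertex lies on at most two hexagons. Fix a planar embedding, so that each hexagon has a clockwise direction. For each $i$ (indices mod $n$, $e_{n+1}=e_1$), let $k_i\in\{1,2,3\}$ be the number of edges of $H_i$ lying strictly between $e_i$ and $e_{i+1}$ when $H_i$ is traversed clockwise starting from $e_i$. The type of $H$ is $M_1M_2\cdots M_n$ with $M_i=t(k_i)$ (so $t(2)$ is linear, $t(1)$ left angular, $t(3)$ right angular attachment). The matrices are $$S=\begin{pmatrix} 1&1&1&1&1&1&1&0&0\\ 0&1&0&1&0&0&1&1&0\\ 0&0&1&1&0&1&0&0&1\\ 0&0&0&1&1&1&1&0&0\\ 1&0&0&1&1&1&1&0&0\\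 0&1&0&0&0&0&0&1&0\\ 0&0&1&0&0&0&0&0&1\\ 1&0&1&1&1&1&1&0&0\\ 1&1&0&1&1&1&1&0&0 \end{pmatrix},\quad L=\begin{pmatrix} 1&1&1&1&1&1&1&0&0\\ 1&0&1&0&0&0&0&0&1\\ 0&1&0&1&0&0&1&1&0\\ 1&0&1&0&0&0&0&0&0\\ 1&0&1&1&0&1&0&0&0\\ 0&0&1&0&0&0&0&0&1\\ 0&1&0&1&0&0&0&0&0\\ 1&1&1&1&0&1&0&0&0\\ 1&0&1&1&1&1&1&0&0 \end{pmatrix},\quad R=\begin{pmatrix} 1&1&1&1&1&1&1&0&0\\ 0&0&1&1&0&1&0&0&1\\ 1&1&0&0&0&0&0&1&0\\ 1&1&0&0&0&0&0&0&0\\ 1&1&0&1&0&0&1&0&0\\ 0&0&1&1&0&0&0&0&0\\ 0&1&0&0&0&0&0&1&0\\ 1&1&0&1&1&1&1&0&0\\ 1&1&1&1&0&0&1&0&0 \end{pmatrix}.$$ -}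

module Defs where

open import Data.Nat using (ℕ; zero; suc; _+_; _*_)
open import Data.Bool using (Bool; true; false; _∧_; _∨_; not; if_then_else_)
open import Data.Fin using (Fin; zero; suc; fromℕ; inject₁; combine; remQuot; _≟_)
open import Data.Product using (_×_; _,_; proj₁; proj₂)
open import Data.List using (List; []; _∷_; map; allFin; length; filterᵇ; _++_; foldr)
open import Data.Bool.ListAction using (all)
open import Data.Nat.ListAction using (sum)
open import Data.Vec using (Vec; []; _∷_; lookup; toList)
open import Relation.Nullary.Decidable using (⌊_⌋)

record Graph : Set where
  field
    V    : ℕ
    E    : ℕ
    ends : Fin E → Fin V × Fin V

EdgeSet : Graph → Set
EdgeSet G = Vec Bool (Graph.E G)

allSubsets : (m : ℕ) → List (Vec Bool m)
allSubsets zero    = [] ∷ []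
allSubsets (suc m) = map (false ∷_) (allSubsets m) ++ map (true ∷_) (allSubsets m)

module _ (G : Graph) where
  open Graph G

  _==ᵛ_ : Fin V → Fin V → Bool
  x ==ᵛ y = ⌊ x ≟ y ⌋

  _==ᵉ_ : Fin E → Fin E → Bool
  e ==ᵉ f = ⌊ e ≟ f ⌋

  adjacentEdges : Fin E → Fin E → Bool
  adjacentEdges e f with ends e | ends f
  ... | (a , b) | (c , d) = (a ==ᵛ c) ∨ (a ==ᵛ d) ∨ (b ==ᵛ c) ∨ (b ==ᵛ d)

  isMatching : EdgeSet G → Bool
  isMatching M =
    all (λ e → all (λ f →
      not (lookup M e ∧ lookup M f ∧ not (e ==ᵉ f) ∧ adjacentEdges e f))
      (allFin E)) (allFin E)

  _⊆ᵇ_ : EdgeSet G → EdgeSet G → Bool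
  M ⊆ᵇ M' = all (λ e → not (lookup M e) ∨ lookup M' e) (allFin E)

  _=ᵇ_ : EdgeSet G → EdgeSet G → Bool
  M =ᵇ M' = (M ⊆ᵇ M') ∧ (M' ⊆ᵇ M)

  isMaximalMatching : EdgeSet G → Bool
  isMaximalMatching M =
    isMatching M ∧
    all (λ M' → not (isMatching M' ∧ (M ⊆ᵇ M')) ∨ (M' =ᵇ M)) (allSubsets E)

Ψ : Graph → ℕ
Ψ G = length (filterᵇ (isMaximalMatching G) (allSubsets (Graph.E G)))

-- attachment types t(1) (left angular), t(2) (linear), t(3) (right angular):
-- t(k) means k edges of H_i lie strictly between e_i and e_{i+1} (clockwise)
data Attach : Set where
  t1 t2 t3 : Attach

kFin : Attach → Fin 4
kFin t1 = suc zero
kFin t2 = suc (suc zero)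
kFin t3 = suc (suc (suc zero))

k-1Fin : Attach → Fin 4
k-1Fin t1 = zero
k-1Fin t2 = suc zero
k-1Fin t3 = suc (suc zero)

predMod : {m : ℕ} → Fin (suc m) → Fin (suc m)
predMod {m} zero = fromℕ m
predMod (suc i) = inject₁ i

-- Vertices: 4n; vertex (i , j) (j = 0..3) is the vertex v_{j+2} of H_i, where
-- v_0 v_1 … v_5 is the clockwise boundary walk of H_i starting with the shared
-- edge e_i = v_0 v_1 (whose vertices belong to H_{i-1}).  Since H_i has k_i
-- edges between e_i and e_{i+1}, e_{i+1} = v_{k_i+1} v_{k_i+2}, traversed in
-- the opposite direction by H_{i+1}; hence v_0, v_1 of H_{i+1} are
-- (i , k_i) and (i , k_i - 1).
-- Edges: 5n; H_i contributes v_1v_2, v_2v_3, v_3v_4, v_4v_5, v_5v_0.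
hexRing : {m : ℕ} → Vec Attach (suc m) → Graph
hexRing {m} ty = record { V = suc m * 4 ; E = suc m * 5 ; ends = ends }
  where
    n = suc m
    vx : Fin n → Fin 4 → Fin (n * 4)
    vx = combine
    ends : Fin (n * 5) → Fin (n * 4) × Fin (n * 4)
    ends e with remQuot {n} 5 e
    ... | (i , zero)                   = (vx (predMod i) (k-1Fin (lookup ty (predMod i))) , vx i zero)
    ... | (i , suc zero)               = (vx i zero , vx i (suc zero))
    ... | (i , suc (suc zero))         = (vx i (suc zero) , vx i (suc (suc zero)))
    ... | (i , suc (suc (suc zero)))   = (vx i (suc (suc zero)) , vx i (suc (suc (suc zero))))
    ... | (i , suc (suc (suc (suc zero)))) = (vx i (suc (suc (suc zero))) , vx (predMod i) (kFin (lookup ty (predMod i))))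

Mat : Set
Mat = Fin 9 → Fin 9 → ℕ

fromRows : Vec (Vec ℕ 9) 9 → Mat
fromRows rows i j = lookup (lookup rows i) j

_⊗_ : Mat → Mat → Mat
(A ⊗ B) i j = sum (map (λ k → A i k * B k j) (allFin 9))

I₉ : Mat
I₉ i j = if ⌊ i ≟ j ⌋ then 1 else 0

tr : Mat → ℕ
tr A = sum (map (λ i → A i i) (allFin 9))

prodM : List Mat → Mat
prodM = foldr _⊗_ I₉

S L R : Mat
S = fromRows
  ((1 ∷ 1 ∷ 1 ∷ 1 ∷ 1 ∷ 1 ∷ 1 ∷ 0 ∷ 0 ∷ []) ∷
   (0 ∷ 1 ∷ 0 ∷ 1 ∷ 0 ∷ 0 ∷ 1 ∷ 1 ∷ 0 ∷ []) ∷
   (0 ∷ 0 ∷ 1 ∷ 1 ∷ 0 ∷ 1 ∷ 0 ∷ 0 ∷ 1 ∷ []) ∷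
   (0 ∷ 0 ∷ 0 ∷ 1 ∷ 1 ∷ 1 ∷ 1 ∷ 0 ∷ 0 ∷ []) ∷
   (1 ∷ 0 ∷ 0 ∷ 1 ∷ 1 ∷ 1 ∷ 1 ∷ 0 ∷ 0 ∷ []) ∷
   (0 ∷ 1 ∷ 0 ∷ 0 ∷ 0 ∷ 0 ∷ 0 ∷ 1 ∷ 0 ∷ []) ∷
   (0 ∷ 0 ∷ 1 ∷ 0 ∷ 0 ∷ 0 ∷ 0 ∷ 0 ∷ 1 ∷ []) ∷
   (1 ∷ 0 ∷ 1 ∷ 1 ∷ 1 ∷ 1 ∷ 1 ∷ 0 ∷ 0 ∷ []) ∷
   (1 ∷ 1 ∷ 0 ∷ 1 ∷ 1 ∷ 1 ∷ 1 ∷ 0 ∷ 0 ∷ []) ∷ [])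
L = fromRows
  ((1 ∷ 1 ∷ 1 ∷ 1 ∷ 1 ∷ 1 ∷ 1 ∷ 0 ∷ 0 ∷ []) ∷
   (1 ∷ 0 ∷ 1 ∷ 0 ∷ 0 ∷ 0 ∷ 0 ∷ 0 ∷ 1 ∷ []) ∷
   (0 ∷ 1 ∷ 0 ∷ 1 ∷ 0 ∷ 0 ∷ 1 ∷ 1 ∷ 0 ∷ []) ∷
   (1 ∷ 0 ∷ 1 ∷ 0 ∷ 0 ∷ 0 ∷ 0 ∷ 0 ∷ 0 ∷ []) ∷
   (1 ∷ 0 ∷ 1 ∷ 1 ∷ 0 ∷ 1 ∷ 0 ∷ 0 ∷ 0 ∷ []) ∷
   (0 ∷ 0 ∷ 1 ∷ 0 ∷ 0 ∷ 0 ∷ 0 ∷ 0 ∷ 1 ∷ []) ∷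
   (0 ∷ 1 ∷ 0 ∷ 1 ∷ 0 ∷ 0 ∷ 0 ∷ 0 ∷ 0 ∷ []) ∷
   (1 ∷ 1 ∷ 1 ∷ 1 ∷ 0 ∷ 1 ∷ 0 ∷ 0 ∷ 0 ∷ []) ∷
   (1 ∷ 0 ∷ 1 ∷ 1 ∷ 1 ∷ 1 ∷ 1 ∷ 0 ∷ 0 ∷ []) ∷ [])
R = fromRows
  ((1 ∷ 1 ∷ 1 ∷ 1 ∷ 1 ∷ 1 ∷ 1 ∷ 0 ∷ 0 ∷ []) ∷
   (0 ∷ 0 ∷ 1 ∷ 1 ∷ 0 ∷ 1 ∷ 0 ∷ 0 ∷ 1 ∷ []) ∷
   (1 ∷ 1 ∷ 0 ∷ 0 ∷ 0 ∷ 0 ∷ 0 ∷ 1 ∷ 0 ∷ []) ∷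
   (1 ∷ 1 ∷ 0 ∷ 0 ∷ 0 ∷ 0 ∷ 0 ∷ 0 ∷ 0 ∷ []) ∷
   (1 ∷ 1 ∷ 0 ∷ 1 ∷ 0 ∷ 0 ∷ 1 ∷ 0 ∷ 0 ∷ []) ∷
   (0 ∷ 0 ∷ 1 ∷ 1 ∷ 0 ∷ 0 ∷ 0 ∷ 0 ∷ 0 ∷ []) ∷
   (0 ∷ 1 ∷ 0 ∷ 0 ∷ 0 ∷ 0 ∷ 0 ∷ 1 ∷ 0 ∷ []) ∷
   (1 ∷ 1 ∷ 0 ∷ 1 ∷ 1 ∷ 1 ∷ 1 ∷ 0 ∷ 0 ∷ []) ∷
   (1 ∷ 1 ∷ 1 ∷ 1 ∷ 0 ∷ 0 ∷ 1 ∷ 0 ∷ 0 ∷ []) ∷ [])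

f : Attach → Mat
f t1 = L
f t2 = S
f t3 = R

-- A maximal matching of the ring is a choice, for every hexagon H_i, of a subset of the
-- five edges of H_i not shared with H_{i-1}. Maximality can be checked hexagon by hexagon
-- once one knows, at every shared edge u w, a state recording which neighbouring hexagon
-- covers u and which covers w, and whether u w itself is chosen; nine states occur. Every
-- local check involves one hexagon and the states at its two shared edges, and the state
-- at a shared edge is determined by the two hexagons containing it. Hence Ψ(H) is the trace
-- of the product of the transfer matrices counting the admissible edge choices in a hexagon
-- between two given states. Evaluation shows that the transfer matrix of type t is B t X and
-- that f t = X B t for explicit 0/1 matrices X and B t, and the trace is unchanged when X is
-- moved from the back of the product to the front.

module Submission where

open import Defs

open import Data.Bool using (Bool; true; false; _∧_; _∨_; not; T; if_then_else_)
open import Data.Bool.ListAction using (all)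
open import Data.Bool.Properties using (T-∧; T-∨; T?)
import Data.Bool.Properties as Bool
open import Data.Empty using (⊥; ⊥-elim)
open import Data.Fin using (Fin; zero; suc; _≟_; toℕ; inject₁; fromℕ; combine; remQuot)
open import Data.Fin.Patterns using (0F; 1F; 2F; 3F; 4F; 5F; 6F; 7F; 8F)
open import Data.Fin.Properties using (suc-injective; any?; remQuot-combine; combine-remQuot; combine-injective; toℕ-inject₁)
open import Data.List using (List; []; _∷_; map; allFin; tabulate; _++_; length; filterᵇ)
open import Data.List.Membership.Propositional using (_∈_)
open import Data.List.Membership.Propositional.Properties using (∈-allFin; ∈-map⁺; ∈-++⁺ˡ; ∈-++⁺ʳ)
open import Data.List.Properties using (map-tabulate; map-++; tabulate-cong)
import Data.List.Relation.Unary.All as All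
open import Data.List.Relation.Unary.All.Properties using (all⁺; all⁻)
open import Data.List.Relation.Unary.Any using (here)
open import Data.Nat using (ℕ; zero; suc; _+_; _*_; _≡ᵇ_)
open import Data.Nat.ListAction using (sum)
open import Data.Nat.ListAction.Properties using (sum-++)
open import Data.Nat.Properties
  using (≡ᵇ⇒≡; 1+n≢n; +-commutativeSemigroup; +-identityʳ; *-zeroʳ; *-identityʳ; *-assoc; *-comm; *-distribˡ-+; *-distribʳ-+)
open import Algebra.Properties.CommutativeSemigroup +-commutativeSemigroup using () renaming (interchange to +-interchange)
open import Data.Product using (_×_; _,_; proj₁; proj₂; ∃)
open import Data.Product.Function.NonDependent.Propositional using (_×-⇔_)
open import Data.Sum using (_⊎_; inj₁; inj₂)
import Data.Sum as Sum
open import Data.Vec using (Vec; []; _∷_; lookup; toList; updateAt) renaming (_++_ to _++ᵛ_; tabulate to tabulateᵛ)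
open import Data.Vec.Properties
  using (lookup∘tabulate; lookup-++ˡ; lookup-++ʳ; tabulate∘lookup; lookup∘updateAt; lookup∘updateAt′)
  renaming (tabulate-cong to tabulateᵛ-cong)
open import Function using (_∘_; _⇔_; mk⇔; Equivalence)
open import Function.Construct.Composition using (_⇔-∘_)
open import Function.Properties.Equivalence using () renaming (sym to ⇔-sym)
open import Relation.Binary.Bundles using (Setoid)
open import Relation.Binary.PropositionalEquality
open import Relation.Nullary using (¬_; yes; no; Dec; _×-dec_)
import Relation.Nullary.Decidable as Dec
open import Relation.Nullary.Decidable using (⌊_⌋; toWitness; fromWitness)

∑ : {A : Set} → List A → (A → ℕ) → ℕ
∑ xs g = sum (map g xs)

module _ {A : Set} where

  ∑-cong : ∀ xs {g h : A → ℕ} → (∀ x → g x ≡ h x) → ∑ xs g ≡ ∑ xs h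
  ∑-cong []       g≗h = refl
  ∑-cong (x ∷ xs) g≗h = cong₂ _+_ (g≗h x) (∑-cong xs g≗h)

  ∑-distrib-+ : ∀ xs (g h : A → ℕ) → ∑ xs (λ x → g x + h x) ≡ ∑ xs g + ∑ xs h
  ∑-distrib-+ []       g h = refl
  ∑-distrib-+ (x ∷ xs) g h =
    trans (cong (g x + h x +_) (∑-distrib-+ xs g h)) (+-interchange (g x) (h x) (∑ xs g) (∑ xs h))

  *-distribˡ-∑ : ∀ c xs (g : A → ℕ) → c * ∑ xs g ≡ ∑ xs (λ x → c * g x)
  *-distribˡ-∑ c []       g = *-zeroʳ c
  *-distribˡ-∑ c (x ∷ xs) g = trans (*-distribˡ-+ c (g x) _) (cong (c * g x +_) (*-distribˡ-∑ c xs g))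

  *-distribʳ-∑ : ∀ c xs (g : A → ℕ) → ∑ xs g * c ≡ ∑ xs (λ x → g x * c)
  *-distribʳ-∑ c []       g = refl
  *-distribʳ-∑ c (x ∷ xs) g = trans (*-distribʳ-+ c (g x) _) (cong (g x * c +_) (*-distribʳ-∑ c xs g))

  ∑-zero : ∀ xs (g : A → ℕ) → (∀ x → g x ≡ 0) → ∑ xs g ≡ 0
  ∑-zero []       g g≗0 = refl
  ∑-zero (x ∷ xs) g g≗0 = cong₂ _+_ (g≗0 x) (∑-zero xs g g≗0)

  ∑-++ : ∀ xs ys (g : A → ℕ) → ∑ (xs ++ ys) g ≡ ∑ xs g + ∑ ys g
  ∑-++ xs ys g = trans (cong sum (map-++ g xs ys)) (sum-++ (map g xs) (map g ys))

  ∑-map : {B : Set} (f : B → A) (xs : List B) (g : A → ℕ) → ∑ (map f xs) g ≡ ∑ xs (g ∘ f)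
  ∑-map f []       g = refl
  ∑-map f (x ∷ xs) g = cong (g (f x) +_) (∑-map f xs g)

∑-comm : {A B : Set} (xs : List A) (ys : List B) (g : A → B → ℕ) →
         ∑ xs (λ x → ∑ ys (g x)) ≡ ∑ ys (λ y → ∑ xs (λ x → g x y))
∑-comm []       ys g = sym (∑-zero ys (λ _ → 0) (λ _ → refl))
∑-comm (x ∷ xs) ys g = trans (cong (∑ ys (g x) +_) (∑-comm xs ys g))
                             (sym (∑-distrib-+ ys (g x) (λ y → ∑ xs (λ x → g x y))))

∑-allFin-suc : ∀ n (g : Fin (suc n) → ℕ) → ∑ (allFin (suc n)) g ≡ g zero + ∑ (allFin n) (g ∘ suc)
∑-allFin-suc n g =
  cong (g zero +_) (trans (cong (λ xs → ∑ xs g) (sym (map-tabulate (λ i → i) suc))) (∑-map suc (allFin n) g))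

∑-allFin-single : ∀ n (g : Fin n → ℕ) d → (∀ i → ¬ i ≡ d → g i ≡ 0) → ∑ (allFin n) g ≡ g d
∑-allFin-single (suc n) g zero    g≗0 = begin
  ∑ (allFin (suc n)) g            ≡⟨ ∑-allFin-suc n g ⟩
  g zero + ∑ (allFin n) (g ∘ suc) ≡⟨ cong (g zero +_) (∑-zero (allFin n) (g ∘ suc) (λ i → g≗0 (suc i) λ ())) ⟩
  g zero + 0                      ≡⟨ +-identityʳ (g zero) ⟩
  g zero                          ∎
  where open ≡-Reasoning
∑-allFin-single (suc n) g (suc d) g≗0 = begin
  ∑ (allFin (suc n)) g            ≡⟨ ∑-allFin-suc n g ⟩
  g zero + ∑ (allFin n) (g ∘ suc) ≡⟨ cong (_+ ∑ (allFin n) (g ∘ suc)) (g≗0 zero λ ()) ⟩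
  ∑ (allFin n) (g ∘ suc)          ≡⟨ ∑-allFin-single n (g ∘ suc) d (λ i i≢d → g≗0 (suc i) (i≢d ∘ suc-injective)) ⟩
  g (suc d)                       ∎
  where open ≡-Reasoning

infix 4 _≈ᴹ_

_≈ᴹ_ : Mat → Mat → Set
A ≈ᴹ B = ∀ i j → A i j ≡ B i j

≈ᴹ-setoid : Setoid _ _
≈ᴹ-setoid = record
  { Carrier       = Mat
  ; _≈_           = _≈ᴹ_
  ; isEquivalence = record
    { refl  = λ _ _ → refl
    ; sym   = λ A≈B i j → sym (A≈B i j)
    ; trans = λ A≈B B≈C i j → trans (A≈B i j) (B≈C i j)
    }
  }

open Setoid ≈ᴹ-setoid using () renaming (refl to ≈ᴹ-refl)

⊗-cong : ∀ {A A′ B B′} → A ≈ᴹ A′ → B ≈ᴹ B′ → A ⊗ B ≈ᴹ A′ ⊗ B′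
⊗-cong A≈A′ B≈B′ i j = ∑-cong (allFin 9) (λ k → cong₂ _*_ (A≈A′ i k) (B≈B′ k j))

⊗-congˡ : ∀ A {B B′} → B ≈ᴹ B′ → A ⊗ B ≈ᴹ A ⊗ B′
⊗-congˡ A = ⊗-cong {A} ≈ᴹ-refl

⊗-assoc : ∀ A B C → (A ⊗ B) ⊗ C ≈ᴹ A ⊗ (B ⊗ C)
⊗-assoc A B C i j = begin
  ∑ F9 (λ k → ∑ F9 (λ l → A i l * B l k) * C k j)
    ≡⟨ ∑-cong F9 (λ k → *-distribʳ-∑ (C k j) F9 (λ l → A i l * B l k)) ⟩
  ∑ F9 (λ k → ∑ F9 (λ l → A i l * B l k * C k j))
    ≡⟨ ∑-comm F9 F9 (λ k l → A i l * B l k * C k j) ⟩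
  ∑ F9 (λ l → ∑ F9 (λ k → A i l * B l k * C k j))
    ≡⟨ ∑-cong F9 (λ l → ∑-cong F9 (λ k → *-assoc (A i l) (B l k) (C k j))) ⟩
  ∑ F9 (λ l → ∑ F9 (λ k → A i l * (B l k * C k j)))
    ≡⟨ ∑-cong F9 (λ l → *-distribˡ-∑ (A i l) F9 (λ k → B l k * C k j)) ⟨
  ∑ F9 (λ l → A i l * ∑ F9 (λ k → B l k * C k j))
    ∎
  where open ≡-Reasoning
        F9 = allFin 9

I₉-diag : ∀ i → I₉ i i ≡ 1
I₉-diag i with i ≟ i
... | yes _  = refl
... | no i≢i = ⊥-elim (i≢i refl)

I₉-off : ∀ {i j} → ¬ i ≡ j → I₉ i j ≡ 0
I₉-off {i} {j} i≢j with i ≟ j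
... | yes i≡j = ⊥-elim (i≢j i≡j)
... | no _    = refl

⊗-identityˡ : ∀ A → I₉ ⊗ A ≈ᴹ A
⊗-identityˡ A i j = begin
  ∑ (allFin 9) (λ k → I₉ i k * A k j)
    ≡⟨ ∑-allFin-single 9 _ i (λ k k≢i → cong (_* A k j) (I₉-off (k≢i ∘ sym))) ⟩
  I₉ i i * A i j
    ≡⟨ cong (_* A i j) (I₉-diag i) ⟩
  1 * A i j
    ≡⟨ +-identityʳ (A i j) ⟩
  A i j
    ∎
  where open ≡-Reasoning

⊗-identityʳ : ∀ A → A ⊗ I₉ ≈ᴹ A
⊗-identityʳ A i j = begin
  ∑ (allFin 9) (λ k → A i k * I₉ k j)
    ≡⟨ ∑-allFin-single 9 _ j (λ k k≢j → trans (cong (A i k *_) (I₉-off k≢j)) (*-zeroʳ (A i k))) ⟩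
  A i j * I₉ j j
    ≡⟨ cong (A i j *_) (I₉-diag j) ⟩
  A i j * 1
    ≡⟨ *-identityʳ (A i j) ⟩
  A i j
    ∎
  where open ≡-Reasoning

tr-cong : ∀ {A B} → A ≈ᴹ B → tr A ≡ tr B
tr-cong A≈B = ∑-cong (allFin 9) (λ i → A≈B i i)

tr-⊗-comm : ∀ A B → tr (A ⊗ B) ≡ tr (B ⊗ A)
tr-⊗-comm A B = trans (∑-comm (allFin 9) (allFin 9) (λ i k → A i k * B k i))
                      (∑-cong (allFin 9) (λ k → ∑-cong (allFin 9) (λ i → *-comm (A i k) (B k i))))

module _ {A : Set} where

  prodM-map-cong : ∀ {F G : A → Mat} → (∀ t → F t ≈ᴹ G t) → ∀ ts → prodM (map F ts) ≈ᴹ prodM (map G ts)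
  prodM-map-cong F≈G []       = ≈ᴹ-refl
  prodM-map-cong F≈G (t ∷ ts) = ⊗-cong (F≈G t) (prodM-map-cong F≈G ts)

  module _ (X : Mat) (B : A → Mat) where

    prodM-slide : ∀ ts → X ⊗ prodM (map (λ t → B t ⊗ X) ts) ≈ᴹ prodM (map (λ t → X ⊗ B t) ts) ⊗ X
    prodM-slide []       = λ i j → trans (⊗-identityʳ X i j) (sym (⊗-identityˡ X i j))
    prodM-slide (t ∷ ts) = begin
      X ⊗ ((B t ⊗ X) ⊗ P)   ≈⟨ ⊗-congˡ X (⊗-assoc (B t) X P) ⟩
      X ⊗ (B t ⊗ (X ⊗ P))   ≈⟨ ⊗-assoc X (B t) (X ⊗ P) ⟨
      (X ⊗ B t) ⊗ (X ⊗ P)   ≈⟨ ⊗-congˡ (X ⊗ B t) (prodM-slide ts) ⟩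
      (X ⊗ B t) ⊗ (Q ⊗ X)   ≈⟨ ⊗-assoc (X ⊗ B t) Q X ⟨
      ((X ⊗ B t) ⊗ Q) ⊗ X   ∎
      where open import Relation.Binary.Reasoning.Setoid ≈ᴹ-setoid
            P = prodM (map (λ t → B t ⊗ X) ts)
            Q = prodM (map (λ t → X ⊗ B t) ts)

    tr-prodM-rotate : ∀ ts → tr (prodM (map (λ t → X ⊗ B t) ts)) ≡ tr (prodM (map (λ t → B t ⊗ X) ts))
    tr-prodM-rotate []       = refl
    tr-prodM-rotate (t ∷ ts) = begin
      tr ((X ⊗ B t) ⊗ Q)   ≡⟨ tr-cong (⊗-assoc X (B t) Q) ⟩
      tr (X ⊗ (B t ⊗ Q))   ≡⟨ tr-⊗-comm X (B t ⊗ Q) ⟩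
      tr ((B t ⊗ Q) ⊗ X)   ≡⟨ tr-cong (⊗-assoc (B t) Q X) ⟩
      tr (B t ⊗ (Q ⊗ X))   ≡⟨ tr-cong (⊗-congˡ (B t) (prodM-slide ts)) ⟨
      tr (B t ⊗ (X ⊗ P))   ≡⟨ tr-cong (⊗-assoc (B t) X P) ⟨
      tr ((B t ⊗ X) ⊗ P)   ∎
      where open ≡-Reasoning
            P = prodM (map (λ t → B t ⊗ X) ts)
            Q = prodM (map (λ t → X ⊗ B t) ts)

∑ᴹ : {A : Set} → List A → (A → Mat) → Mat
∑ᴹ xs F x y = ∑ xs (λ u → F u x y)

⊗-bilinear : {A B : Set} (xs : List A) (ys : List B) (F : A → Mat) (G : B → Mat) →
             ∑ᴹ xs (λ u → ∑ᴹ ys (λ w → F u ⊗ G w)) ≈ᴹ ∑ᴹ xs F ⊗ ∑ᴹ ys G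
⊗-bilinear xs ys F G x y = begin
  ∑ xs (λ u → ∑ ys (λ w → ∑ F9 (λ z → F u x z * G w z y)))
    ≡⟨ ∑-cong xs (λ u → ∑-comm ys F9 (λ w z → F u x z * G w z y)) ⟩
  ∑ xs (λ u → ∑ F9 (λ z → ∑ ys (λ w → F u x z * G w z y)))
    ≡⟨ ∑-cong xs (λ u → ∑-cong F9 (λ z → *-distribˡ-∑ (F u x z) ys (λ w → G w z y))) ⟨
  ∑ xs (λ u → ∑ F9 (λ z → F u x z * ∑ ys (λ w → G w z y)))
    ≡⟨ ∑-comm xs F9 (λ u z → F u x z * ∑ ys (λ w → G w z y)) ⟩
  ∑ F9 (λ z → ∑ xs (λ u → F u x z * ∑ ys (λ w → G w z y)))
    ≡⟨ ∑-cong F9 (λ z → *-distribʳ-∑ (∑ ys (λ w → G w z y)) xs (λ u → F u x z)) ⟨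
  ∑ F9 (λ z → ∑ xs (λ u → F u x z) * ∑ ys (λ w → G w z y))
    ∎
  where open ≡-Reasoning
        F9 = allFin 9

tr-∑ᴹ : {A : Set} (xs : List A) (F : A → Mat) → tr (∑ᴹ xs F) ≡ ∑ xs (λ u → tr (F u))
tr-∑ᴹ xs F = ∑-comm (allFin 9) xs (λ i u → F u i i)

∈-allSubsets : ∀ {m} (v : Vec Bool m) → v ∈ allSubsets m
∈-allSubsets []                 = here refl
∈-allSubsets {suc m} (false ∷ v) = ∈-++⁺ˡ (∈-map⁺ (false ∷_) (∈-allSubsets v))
∈-allSubsets {suc m} (true ∷ v)  = ∈-++⁺ʳ (map (false ∷_) (allSubsets m)) (∈-map⁺ (true ∷_) (∈-allSubsets v))

allSubsets-++ : ∀ a b (g : Vec Bool (a + b) → ℕ) →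
                ∑ (allSubsets (a + b)) g ≡ ∑ (allSubsets a) (λ u → ∑ (allSubsets b) (λ w → g (u ++ᵛ w)))
allSubsets-++ zero    b g = sym (+-identityʳ _)
allSubsets-++ (suc a) b g = begin
  ∑ (map (false ∷_) Sab ++ map (true ∷_) Sab) g
    ≡⟨ ∑-++ (map (false ∷_) Sab) _ g ⟩
  ∑ (map (false ∷_) Sab) g + ∑ (map (true ∷_) Sab) g
    ≡⟨ cong₂ _+_ (∑-map (false ∷_) Sab g) (∑-map (true ∷_) Sab g) ⟩
  ∑ Sab (g ∘ (false ∷_)) + ∑ Sab (g ∘ (true ∷_))
    ≡⟨ cong₂ _+_ (allSubsets-++ a b (g ∘ (false ∷_))) (allSubsets-++ a b (g ∘ (true ∷_))) ⟩
  ∑ Sa (h ∘ (false ∷_)) + ∑ Sa (h ∘ (true ∷_))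
    ≡⟨ cong₂ _+_ (∑-map (false ∷_) Sa h) (∑-map (true ∷_) Sa h) ⟨
  ∑ (map (false ∷_) Sa) h + ∑ (map (true ∷_) Sa) h
    ≡⟨ ∑-++ (map (false ∷_) Sa) _ h ⟨
  ∑ (map (false ∷_) Sa ++ map (true ∷_) Sa) h
    ∎
  where open ≡-Reasoning
        Sab = allSubsets (a + b)
        Sa = allSubsets a
        h : Vec Bool (suc a) → ℕ
        h u = ∑ (allSubsets b) (λ w → g (u ++ᵛ w))

module _ {A : Set} {s : ℕ} where

  block : ∀ {k} → Vec A (k * s) → Fin k → Vec A s
  block v i = tabulateᵛ (λ j → lookup v (combine i j))

  block-++-zero : ∀ {k} (u : Vec A s) (w : Vec A (k * s)) → block {k = suc k} (u ++ᵛ w) zero ≡ u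
  block-++-zero {k} u w = trans (tabulateᵛ-cong (lookup-++ˡ u w)) (tabulate∘lookup u)

  block-++-suc : ∀ {k} (u : Vec A s) (w : Vec A (k * s)) i → block {k = suc k} (u ++ᵛ w) (suc i) ≡ block w i
  block-++-suc u w i = tabulateᵛ-cong (λ j → lookup-++ʳ u w (combine i j))

module _ {A : Set} {s : ℕ} (F : A → Vec Bool s → Mat) where

  blockProduct : ∀ {k} → Vec A k → Vec Bool (k * s) → Mat
  blockProduct ts v = prodM (tabulate (λ i → F (lookup ts i) (block v i)))

  ∑-blockProduct : ∀ {k} (ts : Vec A k) →
    ∑ᴹ (allSubsets (k * s)) (blockProduct ts) ≈ᴹ prodM (map (λ t → ∑ᴹ (allSubsets s) (F t)) (toList ts))
  ∑-blockProduct []       x y = +-identityʳ (I₉ x y)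
  ∑-blockProduct {suc k} (t ∷ ts) x y = begin
    ∑ (allSubsets (s + k * s)) (λ v → blockProduct (t ∷ ts) v x y)
      ≡⟨ allSubsets-++ s (k * s) (λ v → blockProduct (t ∷ ts) v x y) ⟩
    ∑ Su (λ u → ∑ Sw (λ w → blockProduct (t ∷ ts) (u ++ᵛ w) x y))
      ≡⟨ ∑-cong Su (λ u → ∑-cong Sw (λ w → cong (λ M → M x y) (split u w))) ⟩
    ∑ Su (λ u → ∑ Sw (λ w → (F t u ⊗ blockProduct ts w) x y))
      ≡⟨ ⊗-bilinear Su Sw (F t) (blockProduct ts) x y ⟩
    (∑ᴹ Su (F t) ⊗ ∑ᴹ Sw (blockProduct ts)) x y
      ≡⟨ ⊗-congˡ (∑ᴹ Su (F t)) (∑-blockProduct ts) x y ⟩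
    (∑ᴹ Su (F t) ⊗ prodM (map (λ t → ∑ᴹ Su (F t)) (toList ts))) x y
      ∎
    where
    open ≡-Reasoning
    Su = allSubsets s
    Sw = allSubsets (k * s)
    split : ∀ u w → blockProduct (t ∷ ts) (u ++ᵛ w) ≡ F t u ⊗ blockProduct ts w
    split u w = cong₂ (λ b P → F t b ⊗ prodM P) (block-++-zero {k = k} u w)
                      (tabulate-cong (λ i → cong (F (lookup ts i)) (block-++-suc {k = k} u w i)))

indicator : Bool → ℕ
indicator b = if b then 1 else 0

indicator-∧ : ∀ a b → indicator (a ∧ b) ≡ indicator a * indicator b
indicator-∧ true  b = sym (+-identityʳ (indicator b))
indicator-∧ false b = refl

indicator-false : ∀ {b} → ¬ T b → indicator b ≡ 0
indicator-false {false} _  = refl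
indicator-false {true}  ¬b = ⊥-elim (¬b _)

T-⇔⇒≡ : ∀ {a b} → T a ⇔ T b → a ≡ b
T-⇔⇒≡ {false} {false} _   = refl
T-⇔⇒≡ {false} {true}  a⇔b = ⊥-elim (Equivalence.from a⇔b _)
T-⇔⇒≡ {true}  {false} a⇔b = ⊥-elim (Equivalence.to a⇔b _)
T-⇔⇒≡ {true}  {true}  _   = refl

T-not : ∀ {b} → T (not b) ⇔ (¬ T b)
T-not {false} = mk⇔ (λ _ ()) (λ _ → _)
T-not {true}  = mk⇔ (λ ()) (λ ¬b → ¬b _)

T-all : ∀ {A : Set} (p : A → Bool) xs → T (all p xs) ⇔ (∀ {x} → x ∈ xs → T (p x))
T-all p xs = mk⇔ (All.lookup ∘ all⁺ p xs) (all⁻ p ∘ All.tabulate)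

T-all-allFin : ∀ {n} (p : Fin n → Bool) → T (all p (allFin n)) ⇔ (∀ i → T (p i))
T-all-allFin {n} p = mk⇔ (λ h i → Equivalence.to (T-all p (allFin n)) h (∈-allFin i))
                         (λ h → Equivalence.from (T-all p (allFin n)) λ {i} _ → h i)

length-filterᵇ : ∀ {A : Set} (p : A → Bool) xs → length (filterᵇ p xs) ≡ ∑ xs (indicator ∘ p)
length-filterᵇ p []       = refl
length-filterᵇ p (x ∷ xs) with p x
... | true  = cong suc (length-filterᵇ p xs)
... | false = length-filterᵇ p xs

sucMod : ∀ {k} → Fin (suc k) → Fin (suc k)
sucMod {zero}  zero    = zero
sucMod {suc k} zero    = suc zero
sucMod {suc k} (suc i) with sucMod i
... | zero   = zero
... | suc j  = suc (suc j)

sucMod-inject₁ : ∀ {k} (i : Fin k) → sucMod (inject₁ i) ≡ suc i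
sucMod-inject₁ {suc k} zero    = refl
sucMod-inject₁ {suc k} (suc i) rewrite sucMod-inject₁ i = refl

sucMod-fromℕ : ∀ k → sucMod (fromℕ k) ≡ zero
sucMod-fromℕ zero    = refl
sucMod-fromℕ (suc k) rewrite sucMod-fromℕ k = refl

sucMod-predMod : ∀ {k} (i : Fin (suc k)) → sucMod (predMod i) ≡ i
sucMod-predMod {k} zero = sucMod-fromℕ k
sucMod-predMod (suc i)  = sucMod-inject₁ i

predMod-sucMod : ∀ {k} (i : Fin (suc k)) → predMod (sucMod i) ≡ i
predMod-sucMod {zero}  zero    = refl
predMod-sucMod {suc k} zero    = refl
predMod-sucMod {suc k} (suc i) with sucMod i | predMod-sucMod i
... | zero  | p = cong suc p
... | suc j | p = cong suc p

inject₁≢suc : ∀ {k} (i : Fin k) → inject₁ i ≢ suc i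
inject₁≢suc i eq = 1+n≢n (trans (sym (cong toℕ eq)) (toℕ-inject₁ i))

predMod≢ : ∀ {k} (i : Fin (suc (suc k))) → predMod i ≢ i
predMod≢ zero    ()
predMod≢ (suc i) = inject₁≢suc i

-- Since the state between two consecutive steps is forced, at most one path through a product
-- of step matrices contributes to each entry.
module Chains {I : Set} (C : I → Fin 9 → Fin 9 → Bool) (next : I → I → Fin 9)
              (forced : ∀ {p q x y z} → T (C p x y) → T (C q y z) → y ≡ next p q) where

  stepMatrix : I → Mat
  stepMatrix p x y = indicator (C p x y)

  chain : ∀ k → (Fin (suc k) → I) → Fin 9 → Fin 9 → Bool
  chain zero    ρ x y = C (ρ zero) x y
  chain (suc k) ρ x y = C (ρ zero) x z ∧ chain k (ρ ∘ suc) z y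
    where z = next (ρ zero) (ρ (suc zero))

  chain-head : ∀ k ρ {x y} → T (chain k ρ x y) → ∃ λ z → T (C (ρ zero) x z)
  chain-head zero    ρ {y = y} h = y , h
  chain-head (suc k) ρ {x}     h = _ , proj₁ (Equivalence.to (T-∧ {C (ρ zero) x _}) h)

  chain-last : ∀ k ρ {x y} → T (chain k ρ x y) → ∃ λ z → T (C (ρ (fromℕ k)) z y)
  chain-last zero    ρ {x} h = x , h
  chain-last (suc k) ρ {x} h = chain-last k (ρ ∘ suc) (proj₂ (Equivalence.to (T-∧ {C (ρ zero) x _}) h))

  prodM-chain : ∀ k ρ x y → prodM (tabulate (λ i → stepMatrix (ρ i))) x y ≡ indicator (chain k ρ x y)
  prodM-chain zero    ρ x y = ⊗-identityʳ (stepMatrix (ρ zero)) x y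
  prodM-chain (suc k) ρ x y = begin
    ∑ (allFin 9) (λ z → stepMatrix (ρ zero) x z * prodM (tabulate (λ i → stepMatrix (ρ (suc i)))) z y)
      ≡⟨ ∑-cong (allFin 9) (λ z → cong (stepMatrix (ρ zero) x z *_) (prodM-chain k (ρ ∘ suc) z y)) ⟩
    ∑ (allFin 9) (λ z → indicator (C (ρ zero) x z) * indicator (chain k (ρ ∘ suc) z y))
      ≡⟨ ∑-allFin-single 9 _ n off-path ⟩
    indicator (C (ρ zero) x n) * indicator (chain k (ρ ∘ suc) n y)
      ≡⟨ indicator-∧ (C (ρ zero) x n) _ ⟨
    indicator (chain (suc k) ρ x y)
      ∎
    where
    open ≡-Reasoning
    n = next (ρ zero) (ρ (suc zero))
    off-path : ∀ z → ¬ z ≡ n → indicator (C (ρ zero) x z) * indicator (chain k (ρ ∘ suc) z y) ≡ 0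
    off-path z z≢n = trans (sym (indicator-∧ (C (ρ zero) x z) _)) (indicator-false λ h →
      let hx , hz = Equivalence.to (T-∧ {C (ρ zero) x z}) h
      in z≢n (forced hx (proj₂ (chain-head k (ρ ∘ suc) hz))))

  tr-prodM-chain : ∀ k ρ → let s = next (ρ (fromℕ k)) (ρ zero) in
                   tr (prodM (tabulate (λ i → stepMatrix (ρ i)))) ≡ indicator (chain k ρ s s)
  tr-prodM-chain k ρ = trans (∑-cong (allFin 9) (λ x → prodM-chain k ρ x x))
                             (∑-allFin-single 9 _ _ off-cycle)
    where
    off-cycle : ∀ x → ¬ x ≡ next (ρ (fromℕ k)) (ρ zero) → indicator (chain k ρ x x) ≡ 0
    off-cycle x x≢s = indicator-false λ h →
      x≢s (forced (proj₂ (chain-last k ρ h)) (proj₂ (chain-head k ρ h)))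

  T-chain : ∀ k ρ (σ : Fin (suc (suc k)) → Fin 9) →
            (∀ j → σ (suc (inject₁ j)) ≡ next (ρ (inject₁ j)) (ρ (suc j))) →
            T (chain k ρ (σ zero) (σ (fromℕ (suc k)))) ⇔ (∀ i → T (C (ρ i) (σ (inject₁ i)) (σ (suc i))))
  T-chain zero    ρ σ σ-next = mk⇔ (λ { h zero → h }) (λ h → h zero)
  T-chain (suc k) ρ σ σ-next = mk⇔
    (λ h → λ { zero    → proj₁ (split h)
             ; (suc i) → Equivalence.to (T-chain k (ρ ∘ suc) (σ ∘ suc) (σ-next ∘ suc)) (proj₂ (split h)) i })
    (λ h → unsplit (h zero , Equivalence.from (T-chain k (ρ ∘ suc) (σ ∘ suc) (σ-next ∘ suc)) (h ∘ suc)))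
    where
    x = σ zero
    y = σ (fromℕ (suc (suc k)))
    first-step : Fin 9 → Bool
    first-step z = C (ρ zero) x z ∧ chain k (ρ ∘ suc) z y
    split : T (chain (suc k) ρ x y) → T (C (ρ zero) x (σ (suc zero))) × T (chain k (ρ ∘ suc) (σ (suc zero)) y)
    split h = Equivalence.to (T-∧ {C (ρ zero) x (σ (suc zero))}) (subst (T ∘ first-step) (sym (σ-next zero)) h)
    unsplit : T (C (ρ zero) x (σ (suc zero))) × T (chain k (ρ ∘ suc) (σ (suc zero)) y) → T (chain (suc k) ρ x y)
    unsplit p = subst (T ∘ first-step) (σ-next zero) (Equivalence.from T-∧ p)

  module _ {k} (ρ : Fin (suc k) → I) where

    cyclicState : Fin (suc k) → Fin 9
    cyclicState i = next (ρ (predMod i)) (ρ i)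

    T-chain-cycle : T (chain k ρ (cyclicState zero) (cyclicState zero)) ⇔
                    (∀ i → T (C (ρ i) (cyclicState i) (cyclicState (sucMod i))))
    T-chain-cycle = mk⇔
      (λ h i → subst (λ z → T (C (ρ i) z _)) (σ-inject₁ i)
                 (Equivalence.to ⇔σ (subst (λ z → T (chain k ρ (cyclicState zero) z)) (sym σ-last) h) i))
      (λ h → subst (λ z → T (chain k ρ (cyclicState zero) z)) σ-last
               (Equivalence.from ⇔σ λ i → subst (λ z → T (C (ρ i) z _)) (sym (σ-inject₁ i)) (h i)))
      where
      σ : Fin (suc (suc k)) → Fin 9
      σ zero    = cyclicState zero
      σ (suc i) = cyclicState (sucMod i)
      σ-inject₁ : ∀ i → σ (inject₁ i) ≡ cyclicState i
      σ-inject₁ zero    = refl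
      σ-inject₁ (suc i) = cong cyclicState (sucMod-inject₁ i)
      σ-last : σ (fromℕ (suc k)) ≡ cyclicState zero
      σ-last = cong cyclicState (sucMod-fromℕ k)
      ⇔σ : T (chain k ρ (σ zero) (σ (fromℕ (suc k)))) ⇔ (∀ i → T (C (ρ i) (σ (inject₁ i)) (σ (suc i))))
      ⇔σ = T-chain k ρ σ (λ j → cong cyclicState (sucMod-inject₁ j))

-- Maximal matchings

module _ (G : Graph) where
  open Graph G

  _∈ᵉ_ : Fin V → Fin V × Fin V → Set
  v ∈ᵉ (a , b) = v ≡ a ⊎ v ≡ b

  Adjacent : Fin E → Fin E → Set
  Adjacent e f = ∃ λ v → v ∈ᵉ ends e × v ∈ᵉ ends f

  IsMatching : EdgeSet G → Set
  IsMatching M = ∀ e f → T (lookup M e) → T (lookup M f) → e ≢ f → ¬ Adjacent e f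

  IsDominating : EdgeSet G → Set
  IsDominating M = ∀ e → ¬ T (lookup M e) → ∃ λ f → T (lookup M f) × Adjacent e f

  T-adjacentEdges : ∀ e f → T (adjacentEdges G e f) ⇔ Adjacent e f
  T-adjacentEdges e f with ends e | ends f
  ... | (a , b) | (c , d) = mk⇔ to from
    where
    to : T (⌊ a ≟ c ⌋ ∨ ⌊ a ≟ d ⌋ ∨ ⌊ b ≟ c ⌋ ∨ ⌊ b ≟ d ⌋) → ∃ λ v → v ∈ᵉ (a , b) × v ∈ᵉ (c , d)
    to h with Equivalence.to (T-∨ {⌊ a ≟ c ⌋}) h
    ... | inj₁ a≡c = a , inj₁ refl , inj₁ (toWitness a≡c)
    ... | inj₂ h with Equivalence.to (T-∨ {⌊ a ≟ d ⌋}) h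
    ... | inj₁ a≡d = a , inj₁ refl , inj₂ (toWitness a≡d)
    ... | inj₂ h with Equivalence.to (T-∨ {⌊ b ≟ c ⌋}) h
    ... | inj₁ b≡c = b , inj₂ refl , inj₁ (toWitness b≡c)
    ... | inj₂ b≡d = b , inj₂ refl , inj₂ (toWitness b≡d)
    from : (∃ λ v → v ∈ᵉ (a , b) × v ∈ᵉ (c , d)) → T (⌊ a ≟ c ⌋ ∨ ⌊ a ≟ d ⌋ ∨ ⌊ b ≟ c ⌋ ∨ ⌊ b ≟ d ⌋)
    from (v , inj₁ refl , inj₁ refl) = Equivalence.from (T-∨ {⌊ v ≟ v ⌋}) (inj₁ (fromWitness refl))
    from (v , inj₁ refl , inj₂ refl) = Equivalence.from (T-∨ {⌊ v ≟ c ⌋}) (inj₂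
      (Equivalence.from (T-∨ {⌊ v ≟ v ⌋}) (inj₁ (fromWitness refl))))
    from (v , inj₂ refl , inj₁ refl) = Equivalence.from (T-∨ {⌊ a ≟ v ⌋}) (inj₂
      (Equivalence.from (T-∨ {⌊ a ≟ d ⌋}) (inj₂ (Equivalence.from (T-∨ {⌊ v ≟ v ⌋}) (inj₁ (fromWitness refl))))))
    from (v , inj₂ refl , inj₂ refl) = Equivalence.from (T-∨ {⌊ a ≟ c ⌋}) (inj₂
      (Equivalence.from (T-∨ {⌊ a ≟ v ⌋}) (inj₂ (Equivalence.from (T-∨ {⌊ v ≟ c ⌋}) (inj₂ (fromWitness refl))))))

  T-isMatching : ∀ M → T (isMatching G M) ⇔ IsMatching M
  T-isMatching M = mk⇔
    (λ h e f me mf e≢f adj → Equivalence.to T-not (pair-ok h e f)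
       (∧-intro me (∧-intro mf (∧-intro (Equivalence.from T-not (e≢f ∘ toWitness))
                                        (Equivalence.from (T-adjacentEdges e f) adj)))))
    (λ h → Equivalence.from (T-all-allFin _) λ e → Equivalence.from (T-all-allFin _) λ f →
       Equivalence.from T-not λ p →
         let me , p = ∧-elim p ; mf , p = ∧-elim p ; e≢f , adj = ∧-elim p
         in h e f me mf (Equivalence.to T-not e≢f ∘ fromWitness) (Equivalence.to (T-adjacentEdges e f) adj))
    where
    ∧-intro : ∀ {a b} → T a → T b → T (a ∧ b)
    ∧-intro ta tb = Equivalence.from T-∧ (ta , tb)
    ∧-elim : ∀ {a b} → T (a ∧ b) → T a × T b
    ∧-elim {a} = Equivalence.to (T-∧ {a})
    pair-ok : T (isMatching G M) → ∀ e f → T (not (lookup M e ∧ lookup M f ∧ not ⌊ e ≟ f ⌋ ∧ adjacentEdges G e f))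
    pair-ok h e f = Equivalence.to (T-all-allFin _) (Equivalence.to (T-all-allFin _) h e) f

  _⊆ᴱ_ : EdgeSet G → EdgeSet G → Set
  M ⊆ᴱ M′ = ∀ e → T (lookup M e) → T (lookup M′ e)

  IsMaximalMatching : EdgeSet G → Set
  IsMaximalMatching M = IsMatching M × (∀ M′ → IsMatching M′ → M ⊆ᴱ M′ → M′ ⊆ᴱ M)

  T-⊆ᵇ : ∀ M M′ → T (_⊆ᵇ_ G M M′) ⇔ M ⊆ᴱ M′
  T-⊆ᵇ M M′ = mk⇔
    (λ h e → implies⁻ (lookup M e) _ (Equivalence.to (T-all-allFin _) h e))
    (λ h → Equivalence.from (T-all-allFin _) λ e → implies⁺ (lookup M e) _ (h e))
    where
    implies⁺ : ∀ a b → (T a → T b) → T (not a ∨ b)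
    implies⁺ false b _   = _
    implies⁺ true  b a⇒b = a⇒b _
    implies⁻ : ∀ a b → T (not a ∨ b) → T a → T b
    implies⁻ true b tb _ = tb

  T-isMaximalMatching : ∀ M → T (isMaximalMatching G M) ⇔ IsMaximalMatching M
  T-isMaximalMatching M = mk⇔
    (λ h → let m , h = Equivalence.to (T-∧ {isMatching G M}) h in
       Equivalence.to (T-isMatching M) m , λ M′ m′ M⊆M′ →
         maximal⁻ M′ (Equivalence.to (T-all _ (allSubsets E)) h (∈-allSubsets M′))
                     (Equivalence.from (T-isMatching M′) m′) M⊆M′)
    (λ (m , max) → Equivalence.from T-∧ (Equivalence.from (T-isMatching M) m ,
       Equivalence.from (T-all _ (allSubsets E)) λ {M′} _ → maximal⁺ M′ (max M′ ∘ Equivalence.to (T-isMatching M′))))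
    where
    maximal⁻ : ∀ M′ → T (not (isMatching G M′ ∧ (_⊆ᵇ_ G M M′)) ∨ (_=ᵇ_ G M′ M)) →
               T (isMatching G M′) → M ⊆ᴱ M′ → M′ ⊆ᴱ M
    maximal⁻ M′ h m′ M⊆M′ with Equivalence.to (T-∨ {not (isMatching G M′ ∧ _⊆ᵇ_ G M M′)}) h
    ... | inj₁ ¬ext = ⊥-elim (Equivalence.to T-not ¬ext (Equivalence.from T-∧ (m′ , Equivalence.from (T-⊆ᵇ M M′) M⊆M′)))
    ... | inj₂ M′=M = Equivalence.to (T-⊆ᵇ M′ M) (proj₁ (Equivalence.to (T-∧ {_⊆ᵇ_ G M′ M}) M′=M))
    maximal⁺ : ∀ M′ → (T (isMatching G M′) → M ⊆ᴱ M′ → M′ ⊆ᴱ M) →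
               T (not (isMatching G M′ ∧ (_⊆ᵇ_ G M M′)) ∨ (_=ᵇ_ G M′ M))
    maximal⁺ M′ max with T? (isMatching G M′ ∧ _⊆ᵇ_ G M M′)
    ... | no ¬ext = Equivalence.from T-∨ (inj₁ (Equivalence.from T-not ¬ext))
    ... | yes ext = Equivalence.from T-∨ (inj₂ (Equivalence.from T-∧
            (Equivalence.from (T-⊆ᵇ M′ M) (max m′ (Equivalence.to (T-⊆ᵇ M M′) M⊆ᵇM′)) , M⊆ᵇM′)))
      where m′   = proj₁ (Equivalence.to (T-∧ {isMatching G M′}) ext)
            M⊆ᵇM′ = proj₂ (Equivalence.to (T-∧ {isMatching G M′}) ext)

  Adjacent-sym : ∀ {e f} → Adjacent e f → Adjacent f e
  Adjacent-sym (v , v∈e , v∈f) = v , v∈f , v∈e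

  maximal⇔matching×dominating : ∀ M → IsMaximalMatching M ⇔ (IsMatching M × IsDominating M)
  maximal⇔matching×dominating M = mk⇔ (λ (m , max) → m , dominating m max) (λ (m , d) → m , maximal m d)
    where
    maximal : IsMatching M → IsDominating M → ∀ M′ → IsMatching M′ → M ⊆ᴱ M′ → M′ ⊆ᴱ M
    maximal m d M′ m′ M⊆M′ e e∈M′ with T? (lookup M e)
    ... | yes e∈M = e∈M
    ... | no  e∉M = let f , f∈M , adj = d e e∉M in
      ⊥-elim (m′ e f e∈M′ (M⊆M′ f f∈M) (λ e≡f → e∉M (subst (T ∘ lookup M) (sym e≡f) f∈M)) adj)

    dominating : IsMatching M → (∀ M′ → IsMatching M′ → M ⊆ᴱ M′ → M′ ⊆ᴱ M) → IsDominating M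
    dominating m max e e∉M with any? (λ f → T? (lookup M f) ×-dec adjacent? e f)
      where adjacent? : ∀ e f → Dec (Adjacent e f)
            adjacent? e f = Dec.map (T-adjacentEdges e f) (T? (adjacentEdges G e f))
    ... | yes found = found
    ... | no  none  = ⊥-elim (e∉M (max M′ m′ M⊆M′ e (subst T (sym (lookup∘updateAt e M)) _)))
      where
      M′ = updateAt M e (λ _ → true)
      M⊆M′ : M ⊆ᴱ M′
      M⊆M′ g g∈M with g ≟ e
      ... | yes refl = ⊥-elim (e∉M g∈M)
      ... | no  g≢e  = subst T (sym (lookup∘updateAt′ g e g≢e M)) g∈M
      in-M′ : ∀ g → T (lookup M′ g) → g ≡ e ⊎ T (lookup M g)
      in-M′ g g∈M′ with g ≟ e
      ... | yes g≡e = inj₁ g≡e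
      ... | no  g≢e = inj₂ (subst T (lookup∘updateAt′ g e g≢e M) g∈M′)
      m′ : IsMatching M′
      m′ g g′ g∈M′ g′∈M′ g≢g′ adj with in-M′ g g∈M′ | in-M′ g′ g′∈M′
      ... | inj₁ refl | inj₁ refl = g≢g′ refl
      ... | inj₁ refl | inj₂ g′∈M = none (g′ , g′∈M , adj)
      ... | inj₂ g∈M  | inj₁ refl = none (g , g∈M , Adjacent-sym adj)
      ... | inj₂ g∈M  | inj₂ g′∈M = m g g′ g∈M g′∈M g≢g′ adj

  isMaximalMatching⇔matching×dominating : ∀ M → T (isMaximalMatching G M) ⇔ (IsMatching M × IsDominating M)
  isMaximalMatching⇔matching×dominating M = maximal⇔matching×dominating M ⇔-∘ T-isMaximalMatching M

-- Interface states

-- The state at a shared edge u w records, for u and for w, whether it is covered by an edge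
-- of the hexagon on the Left, on the Right, or Neither; in LLE the edge u w is chosen as well.
State : Set
State = Fin 9

pattern LL  = 0F
pattern LR  = 1F
pattern LN  = 2F
pattern RL  = 3F
pattern RR  = 4F
pattern RN  = 5F
pattern NL  = 6F
pattern NR  = 7F
pattern LLE = 8F

uLeft uRight wLeft wRight sharedChosen : State → Bool
uLeft LL  = true
uLeft LR  = true
uLeft LN  = true
uLeft LLE = true
uLeft _   = false

uRight RL = true
uRight RR = true
uRight RN = true
uRight _  = false

wLeft LL  = true
wLeft RL  = true
wLeft NL  = true
wLeft LLE = true
wLeft _   = false

wRight LR = true
wRight RR = true
wRight NR = true
wRight _  = false

sharedChosen LLE = true
sharedChosen _   = false

-- Invalid combinations of flags are sent to LL.
state : (uL uR wL wR e : Bool) → State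
state true  false true  false false = LL
state true  false false true  false = LR
state true  false false false false = LN
state false true  true  false false = RL
state false true  false true  false = RR
state false true  false false false = RN
state false false true  false false = NL
state false false false true  false = NR
state true  false true  false true  = LLE
state _     _     _     _     _     = LL

state-flags : ∀ s → state (uLeft s) (uRight s) (wLeft s) (wRight s) (sharedChosen s) ≡ s
state-flags LL  = refl
state-flags LR  = refl
state-flags LN  = refl
state-flags RL  = refl
state-flags RR  = refl
state-flags RN  = refl
state-flags NL  = refl
state-flags NR  = refl
state-flags LLE = refl

validFlags : (uL uR wL wR e : Bool) → Bool
validFlags uL uR wL wR e = not (uL ∧ uR) ∧ not (wL ∧ wR) ∧ (uL ∨ uR ∨ wL ∨ wR) ∧ (not e ∨ uL ∧ wL)

record HasFlags (s : State) (uL uR wL wR e : Bool) : Set where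
  constructor hasFlags
  field
    uLeft≡   : uLeft s ≡ uL
    uRight≡  : uRight s ≡ uR
    wLeft≡   : wLeft s ≡ wL
    wRight≡  : wRight s ≡ wR
    shared≡  : sharedChosen s ≡ e

state-hasFlags : ∀ uL uR wL wR e → T (validFlags uL uR wL wR e) → HasFlags (state uL uR wL wR e) uL uR wL wR e
state-hasFlags true  true  _     _     _     ()
state-hasFlags true  false true  true  _     ()
state-hasFlags false true  true  true  _     ()
state-hasFlags false false true  true  _     ()
state-hasFlags false false false false _     ()
state-hasFlags true  false true  false false _ = hasFlags refl refl refl refl refl
state-hasFlags true  false false true  false _ = hasFlags refl refl refl refl refl
state-hasFlags true  false false false false _ = hasFlags refl refl refl refl refl
state-hasFlags false true  true  false false _ = hasFlags refl refl refl refl refl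
state-hasFlags false true  false true  false _ = hasFlags refl refl refl refl refl
state-hasFlags false true  false false false _ = hasFlags refl refl refl refl refl
state-hasFlags false false true  false false _ = hasFlags refl refl refl refl refl
state-hasFlags false false false true  false _ = hasFlags refl refl refl refl refl
state-hasFlags true  false true  false true  _ = hasFlags refl refl refl refl refl
state-hasFlags true  false false true  true  ()
state-hasFlags true  false false false true  ()
state-hasFlags false true  true  false true  ()
state-hasFlags false true  false true  true  ()
state-hasFlags false true  false false true  ()
state-hasFlags false false true  false true  ()
state-hasFlags false false false true  true  ()

hasFlags⇒≡state : ∀ {s uL uR wL wR e} → HasFlags s uL uR wL wR e → s ≡ state uL uR wL wR e
hasFlags⇒≡state {s} (hasFlags refl refl refl refl refl) = sym (state-flags s)

validFlags-state : ∀ s → T (validFlags (uLeft s) (uRight s) (wLeft s) (wRight s) (sharedChosen s))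
validFlags-state LL  = _
validFlags-state LR  = _
validFlags-state LN  = _
validFlags-state RL  = _
validFlags-state RR  = _
validFlags-state RN  = _
validFlags-state NL  = _
validFlags-state NR  = _
validFlags-state LLE = _

hasFlags⇒validFlags : ∀ {s uL uR wL wR e} → HasFlags s uL uR wL wR e → T (validFlags uL uR wL wR e)
hasFlags⇒validFlags {s} (hasFlags refl refl refl refl refl) = validFlags-state s

validFlags-intro : ∀ {uL uR wL wR e} → ¬ (T uL × T uR) → ¬ (T wL × T wR) → T (uL ∨ uR ∨ wL ∨ wR) →
                   (T e → T (uL ∧ wL)) → T (validFlags uL uR wL wR e)
validFlags-intro {uL} {uR} {wL} {wR} {e} u w some shared =
  Equivalence.from (T-∧ {not (uL ∧ uR)}) (Equivalence.from T-not (u ∘ Equivalence.to T-∧) ,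
  Equivalence.from (T-∧ {not (wL ∧ wR)}) (Equivalence.from T-not (w ∘ Equivalence.to T-∧) ,
  Equivalence.from (T-∧ {uL ∨ uR ∨ wL ∨ wR}) (some , implication e shared)))
  where implication : ∀ e {a} → (T e → T a) → T (not e ∨ a)
        implication false _   = _
        implication true  e⇒a = e⇒a _

validFlags-elim : ∀ {uL uR wL wR e} → T (validFlags uL uR wL wR e) → ¬ (T uL × T uR) × ¬ (T wL × T wR)
validFlags-elim {uL} {uR} {wL} {wR} h =
  let u , h = Equivalence.to (T-∧ {not (uL ∧ uR)}) h
      w , _ = Equivalence.to (T-∧ {not (wL ∧ wR)}) h
  in Equivalence.to T-not u ∘ Equivalence.from T-∧ , Equivalence.to T-not w ∘ Equivalence.from T-∧

-- Hexagon blocks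

-- The edges of H_i numbered as in hexRing: its own vertex x lies on the edges x and x + 1.
Block : Set
Block = Vec Bool 5

sharedEdge : Attach → Fin 5
sharedEdge t = suc (k-1Fin t)

ownCovered : Block → Fin 4 → Bool
ownCovered b x = lookup b (inject₁ x) ∨ lookup b (suc x)

ownMatching : Block → Bool
ownMatching b = all (λ x → not (lookup b (inject₁ x) ∧ lookup b (suc x))) (allFin 4)

-- The vertices k-1 and k of H_i also lie on the edges 0 and 4 of H_{i+1}, chosen iff uR and wR.
vertexCovered : Attach → (uR wR : Bool) → Block → Fin 4 → Bool
vertexCovered t uR wR b x = ownCovered b x ∨ (⌊ x ≟ k-1Fin t ⌋ ∧ uR) ∨ (⌊ x ≟ kFin t ⌋ ∧ wR)

edgeDominated : Attach → (uL wL uR wR : Bool) → Block → Fin 5 → Bool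
edgeDominated t uL wL uR wR b 0F = lookup b 0F ∨ uL ∨ vertexCovered t uR wR b 0F
edgeDominated t uL wL uR wR b 1F = lookup b 1F ∨ vertexCovered t uR wR b 0F ∨ vertexCovered t uR wR b 1F
edgeDominated t uL wL uR wR b 2F = lookup b 2F ∨ vertexCovered t uR wR b 1F ∨ vertexCovered t uR wR b 2F
edgeDominated t uL wL uR wR b 3F = lookup b 3F ∨ vertexCovered t uR wR b 2F ∨ vertexCovered t uR wR b 3F
edgeDominated t uL wL uR wR b 4F = lookup b 4F ∨ vertexCovered t uR wR b 3F ∨ wL

k-1≢k : ∀ t → k-1Fin t ≢ kFin t
k-1≢k t1 ()
k-1≢k t2 ()
k-1≢k t3 ()

vertexCovered-k-1 : ∀ t uR wR b → vertexCovered t uR wR b (k-1Fin t) ≡ ownCovered b (k-1Fin t) ∨ uR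
vertexCovered-k-1 t1 uR wR b = cong (ownCovered b 0F ∨_) (Bool.∨-identityʳ uR)
vertexCovered-k-1 t2 uR wR b = cong (ownCovered b 1F ∨_) (Bool.∨-identityʳ uR)
vertexCovered-k-1 t3 uR wR b = cong (ownCovered b 2F ∨_) (Bool.∨-identityʳ uR)

vertexCovered-k : ∀ t uR wR b → vertexCovered t uR wR b (kFin t) ≡ ownCovered b (kFin t) ∨ wR
vertexCovered-k t1 uR wR b = refl
vertexCovered-k t2 uR wR b = refl
vertexCovered-k t3 uR wR b = refl

_==_ : Bool → Bool → Bool
a == b = ⌊ a Bool.≟ b ⌋

-- Opaque, because unfolding it makes the conversion checks of the ring section very slow.
opaque
  compatible : Attach → State → Block → State → Bool
  compatible t x b z =
    (uRight x == lookup b 0F) ∧ (wRight x == lookup b 4F) ∧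
    (uLeft z == ownCovered b (k-1Fin t)) ∧ (wLeft z == ownCovered b (kFin t)) ∧
    (sharedChosen z == lookup b (sharedEdge t)) ∧
    ownMatching b ∧ all (edgeDominated t (uLeft x) (wLeft x) (uRight z) (wRight z) b) (allFin 5)

record Compatible (t : Attach) (x : State) (b : Block) (z : State) : Set where
  field
    uRight-in  : uRight x ≡ lookup b 0F
    wRight-in  : wRight x ≡ lookup b 4F
    uLeft-out  : uLeft z ≡ ownCovered b (k-1Fin t)
    wLeft-out  : wLeft z ≡ ownCovered b (kFin t)
    shared-out : sharedChosen z ≡ lookup b (sharedEdge t)
    own        : T (ownMatching b)
    dominated  : T (all (edgeDominated t (uLeft x) (wLeft x) (uRight z) (wRight z) b) (allFin 5))

opaque
  unfolding compatible

  T-compatible : ∀ t x b z → T (compatible t x b z) ⇔ Compatible t x b z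
  T-compatible t x b z = mk⇔ to from
    where
    to : T (compatible t x b z) → Compatible t x b z
    to h =
      let r₀ , h = Equivalence.to (T-∧ {uRight x == lookup b 0F}) h
          r₄ , h = Equivalence.to (T-∧ {wRight x == lookup b 4F}) h
          u  , h = Equivalence.to (T-∧ {uLeft z == ownCovered b (k-1Fin t)}) h
          w  , h = Equivalence.to (T-∧ {wLeft z == ownCovered b (kFin t)}) h
          e  , h = Equivalence.to (T-∧ {sharedChosen z == lookup b (sharedEdge t)}) h
          o  , d = Equivalence.to (T-∧ {ownMatching b}) h
      in record { uRight-in = toWitness r₀ ; wRight-in = toWitness r₄ ; uLeft-out = toWitness u
                ; wLeft-out = toWitness w ; shared-out = toWitness e ; own = o ; dominated = d }
    from : Compatible t x b z → T (compatible t x b z)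
    from c =
      ∧-intro (uRight x == lookup b 0F) (fromWitness uRight-in) (∧-intro (wRight x == lookup b 4F) (fromWitness wRight-in)
        (∧-intro (uLeft z == _) (fromWitness uLeft-out) (∧-intro (wLeft z == _) (fromWitness wLeft-out)
          (∧-intro (sharedChosen z == _) (fromWitness shared-out) (∧-intro (ownMatching b) own dominated)))))
      where open Compatible c
            ∧-intro : ∀ a {b} → T a → T b → T (a ∧ b)
            ∧-intro a ta tb = Equivalence.from (T-∧ {a}) (ta , tb)

interfaceState : Attach × Block → Attach × Block → State
interfaceState (t , b) (t′ , b′) =
  state (ownCovered b (k-1Fin t)) (lookup b′ 0F) (ownCovered b (kFin t)) (lookup b′ 4F) (lookup b (sharedEdge t))

compatibleᵖ : Attach × Block → State → State → Bool
compatibleᵖ (t , b) x z = compatible t x b z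

compatible-forced : ∀ {p q x y z} → T (compatibleᵖ p x y) → T (compatibleᵖ q y z) → y ≡ interfaceState p q
compatible-forced {t , b} {t′ , b′} {x} {y} {z} cp cq =
  hasFlags⇒≡state (hasFlags uLeft-out (Compatible.uRight-in c′) wLeft-out (Compatible.wRight-in c′) shared-out)
  where open Compatible (Equivalence.to (T-compatible t x b y) cp)
        c′ = Equivalence.to (T-compatible t′ y b′ z) cq

-- Transfer matrices

open Chains compatibleᵖ interfaceState (λ {p} {q} {x} {y} {z} → compatible-forced {p} {q} {x} {y} {z})

blockMatrix : Attach → Block → Mat
blockMatrix t b = stepMatrix (t , b)

transfer : Attach → Mat
transfer t = ∑ᴹ (allSubsets 5) (blockMatrix t)

X : Mat
X = fromRows
  ((0 ∷ 0 ∷ 0 ∷ 0 ∷ 1 ∷ 1 ∷ 0 ∷ 1 ∷ 1 ∷ []) ∷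
   (0 ∷ 1 ∷ 1 ∷ 0 ∷ 0 ∷ 0 ∷ 0 ∷ 0 ∷ 0 ∷ []) ∷
   (0 ∷ 0 ∷ 0 ∷ 1 ∷ 0 ∷ 0 ∷ 1 ∷ 0 ∷ 0 ∷ []) ∷
   (1 ∷ 0 ∷ 0 ∷ 0 ∷ 0 ∷ 0 ∷ 0 ∷ 0 ∷ 0 ∷ []) ∷
   (0 ∷ 0 ∷ 0 ∷ 0 ∷ 1 ∷ 0 ∷ 0 ∷ 0 ∷ 1 ∷ []) ∷
   (0 ∷ 1 ∷ 0 ∷ 0 ∷ 0 ∷ 0 ∷ 0 ∷ 0 ∷ 0 ∷ []) ∷
   (0 ∷ 0 ∷ 0 ∷ 1 ∷ 0 ∷ 0 ∷ 0 ∷ 0 ∷ 0 ∷ []) ∷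
   (0 ∷ 0 ∷ 0 ∷ 0 ∷ 1 ∷ 1 ∷ 0 ∷ 0 ∷ 1 ∷ []) ∷
   (0 ∷ 0 ∷ 0 ∷ 0 ∷ 1 ∷ 0 ∷ 0 ∷ 1 ∷ 1 ∷ []) ∷ [])

B : Attach → Mat
B t1 = fromRows
  ((1 ∷ 0 ∷ 1 ∷ 0 ∷ 0 ∷ 0 ∷ 0 ∷ 0 ∷ 0 ∷ []) ∷
   (0 ∷ 0 ∷ 1 ∷ 0 ∷ 0 ∷ 0 ∷ 0 ∷ 0 ∷ 1 ∷ []) ∷
   (1 ∷ 0 ∷ 0 ∷ 0 ∷ 0 ∷ 0 ∷ 0 ∷ 0 ∷ 0 ∷ []) ∷
   (0 ∷ 1 ∷ 0 ∷ 1 ∷ 0 ∷ 0 ∷ 0 ∷ 0 ∷ 0 ∷ []) ∷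
   (0 ∷ 0 ∷ 0 ∷ 1 ∷ 0 ∷ 1 ∷ 0 ∷ 0 ∷ 0 ∷ []) ∷
   (0 ∷ 1 ∷ 0 ∷ 0 ∷ 0 ∷ 0 ∷ 0 ∷ 0 ∷ 0 ∷ []) ∷
   (0 ∷ 0 ∷ 0 ∷ 0 ∷ 0 ∷ 0 ∷ 1 ∷ 1 ∷ 0 ∷ []) ∷
   (0 ∷ 0 ∷ 0 ∷ 0 ∷ 1 ∷ 0 ∷ 1 ∷ 0 ∷ 0 ∷ []) ∷
   (1 ∷ 0 ∷ 1 ∷ 0 ∷ 0 ∷ 0 ∷ 0 ∷ 0 ∷ 0 ∷ []) ∷ [])
B t2 = fromRows
  ((0 ∷ 0 ∷ 0 ∷ 1 ∷ 1 ∷ 1 ∷ 1 ∷ 0 ∷ 0 ∷ []) ∷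
   (0 ∷ 1 ∷ 0 ∷ 0 ∷ 0 ∷ 0 ∷ 0 ∷ 1 ∷ 0 ∷ []) ∷
   (0 ∷ 0 ∷ 0 ∷ 1 ∷ 0 ∷ 0 ∷ 1 ∷ 0 ∷ 0 ∷ []) ∷
   (0 ∷ 0 ∷ 1 ∷ 0 ∷ 0 ∷ 0 ∷ 0 ∷ 0 ∷ 1 ∷ []) ∷
   (1 ∷ 0 ∷ 0 ∷ 0 ∷ 0 ∷ 0 ∷ 0 ∷ 0 ∷ 0 ∷ []) ∷
   (0 ∷ 0 ∷ 1 ∷ 0 ∷ 0 ∷ 0 ∷ 0 ∷ 0 ∷ 0 ∷ []) ∷
   (0 ∷ 0 ∷ 0 ∷ 1 ∷ 0 ∷ 1 ∷ 0 ∷ 0 ∷ 0 ∷ []) ∷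
   (0 ∷ 1 ∷ 0 ∷ 0 ∷ 0 ∷ 0 ∷ 0 ∷ 0 ∷ 0 ∷ []) ∷
   (0 ∷ 0 ∷ 0 ∷ 1 ∷ 1 ∷ 1 ∷ 1 ∷ 0 ∷ 0 ∷ []) ∷ [])
B t3 = fromRows
  ((1 ∷ 1 ∷ 0 ∷ 0 ∷ 0 ∷ 0 ∷ 0 ∷ 0 ∷ 0 ∷ []) ∷
   (0 ∷ 0 ∷ 1 ∷ 1 ∷ 0 ∷ 0 ∷ 0 ∷ 0 ∷ 0 ∷ []) ∷
   (0 ∷ 0 ∷ 0 ∷ 0 ∷ 0 ∷ 1 ∷ 0 ∷ 0 ∷ 1 ∷ []) ∷
   (0 ∷ 1 ∷ 0 ∷ 0 ∷ 0 ∷ 0 ∷ 0 ∷ 1 ∷ 0 ∷ []) ∷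
   (0 ∷ 0 ∷ 0 ∷ 1 ∷ 0 ∷ 0 ∷ 1 ∷ 0 ∷ 0 ∷ []) ∷
   (0 ∷ 0 ∷ 0 ∷ 0 ∷ 1 ∷ 1 ∷ 0 ∷ 0 ∷ 0 ∷ []) ∷
   (1 ∷ 0 ∷ 0 ∷ 0 ∷ 0 ∷ 0 ∷ 0 ∷ 0 ∷ 0 ∷ []) ∷
   (0 ∷ 0 ∷ 1 ∷ 0 ∷ 0 ∷ 0 ∷ 0 ∷ 0 ∷ 0 ∷ []) ∷
   (1 ∷ 1 ∷ 0 ∷ 0 ∷ 0 ∷ 0 ∷ 0 ∷ 0 ∷ 0 ∷ []) ∷ [])

_==ᴹ_ : Mat → Mat → Bool
A ==ᴹ A′ = all (λ i → all (λ j → A i j ≡ᵇ A′ i j) (allFin 9)) (allFin 9)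

==ᴹ-sound : ∀ A A′ → T (A ==ᴹ A′) → A ≈ᴹ A′
==ᴹ-sound A A′ h i j =
  ≡ᵇ⇒≡ (A i j) (A′ i j) (Equivalence.to (T-all-allFin (λ j → A i j ≡ᵇ A′ i j))
    (Equivalence.to (T-all-allFin (λ i → all (λ j → A i j ≡ᵇ A′ i j) (allFin 9))) h i) j)

opaque
  unfolding compatible

  transfer-factorisation : ∀ t → transfer t ≈ᴹ B t ⊗ X
  transfer-factorisation t1 = ==ᴹ-sound (transfer t1) (B t1 ⊗ X) _
  transfer-factorisation t2 = ==ᴹ-sound (transfer t2) (B t2 ⊗ X) _
  transfer-factorisation t3 = ==ᴹ-sound (transfer t3) (B t3 ⊗ X) _

f-factorisation : ∀ t → f t ≈ᴹ X ⊗ B t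
f-factorisation t1 = ==ᴹ-sound (f t1) (X ⊗ B t1) _
f-factorisation t2 = ==ᴹ-sound (f t2) (X ⊗ B t2) _
f-factorisation t3 = ==ᴹ-sound (f t3) (X ⊗ B t3) _

-- The ring

module Ring (m : ℕ) (ty : Vec Attach (3 + m)) (M : Vec Bool ((3 + m) * 5)) where

  n : ℕ
  n = 3 + m

  type : Fin n → Attach
  type = lookup ty

  blk : Fin n → Block
  blk = block M

  Vertex Edge : Set
  Vertex = Fin n × Fin 4
  Edge   = Fin n × Fin 5

  endpoints : Edge → Vertex × Vertex
  endpoints (i , 0F) = (predMod i , k-1Fin (type (predMod i))) , (i , 0F)
  endpoints (i , 1F) = (i , 0F) , (i , 1F)
  endpoints (i , 2F) = (i , 1F) , (i , 2F)
  endpoints (i , 3F) = (i , 2F) , (i , 3F)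
  endpoints (i , 4F) = (i , 3F) , (predMod i , kFin (type (predMod i)))

  vertexIndex : Vertex → Fin (n * 4)
  vertexIndex (a , x) = combine a x

  edgeIndex : Edge → Fin (n * 5)
  edgeIndex (i , j) = combine i j

  ends-edgeIndex : ∀ e → Graph.ends (hexRing ty) (edgeIndex e) ≡
                         (vertexIndex (proj₁ (endpoints e)) , vertexIndex (proj₂ (endpoints e)))
  ends-edgeIndex (i , j) rewrite remQuot-combine {n} {5} i j with j
  ... | 0F = refl
  ... | 1F = refl
  ... | 2F = refl
  ... | 3F = refl
  ... | 4F = refl

  _At_ : Vertex → Edge → Set
  v At e = v ≡ proj₁ (endpoints e) ⊎ v ≡ proj₂ (endpoints e)

  chosen : Edge → Bool
  chosen (i , j) = lookup (blk i) j

  chosen-edgeIndex : ∀ e → chosen e ≡ lookup M (edgeIndex e)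
  chosen-edgeIndex (i , j) = lookup∘tabulate (λ j → lookup M (combine i j)) j

  RingMatching : Set
  RingMatching = ∀ e e′ v → T (chosen e) → T (chosen e′) → e ≢ e′ → v At e → v At e′ → ⊥

  RingDominating : Set
  RingDominating = ∀ e → ¬ T (chosen e) → ∃ λ v → v At e × ∃ λ e′ → T (chosen e′) × v At e′

  ∈ᵉ-ends⇔At : ∀ v e → _∈ᵉ_ (hexRing ty) (vertexIndex v) (Graph.ends (hexRing ty) (edgeIndex e)) ⇔ v At e
  ∈ᵉ-ends⇔At v e rewrite ends-edgeIndex e = mk⇔ (Sum.map injective injective) (Sum.map (cong vertexIndex) (cong vertexIndex))
    where injective : ∀ {v w} → vertexIndex v ≡ vertexIndex w → v ≡ w
          injective {a , x} {b , y} eq = let a≡b , x≡y = combine-injective a x b y eq in cong₂ _,_ a≡b x≡y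

  adjacent⇔ : ∀ e e′ → Adjacent (hexRing ty) (edgeIndex e) (edgeIndex e′) ⇔ (∃ λ v → v At e × v At e′)
  adjacent⇔ e e′ = mk⇔
    (λ (w , w∈e , w∈e′) → let v = remQuot {n} 4 w ; w≡v = sym (combine-remQuot {n} 4 w) in
        v , Equivalence.to (∈ᵉ-ends⇔At v e) (subst (λ u → _∈ᵉ_ (hexRing ty) u _) w≡v w∈e)
          , Equivalence.to (∈ᵉ-ends⇔At v e′) (subst (λ u → _∈ᵉ_ (hexRing ty) u _) w≡v w∈e′))
    (λ (v , at , at′) → vertexIndex v , Equivalence.from (∈ᵉ-ends⇔At v e) at , Equivalence.from (∈ᵉ-ends⇔At v e′) at′)

  every-edgeIndex : {P : Fin (n * 5) → Set} → (∀ e → P (edgeIndex e)) → ∀ f → P f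
  every-edgeIndex {P} h f = subst P (combine-remQuot {n} 5 f) (h (remQuot {n} 5 f))

  edgeIndex-injective : ∀ {e e′} → edgeIndex e ≡ edgeIndex e′ → e ≡ e′
  edgeIndex-injective {i , j} {i′ , j′} eq = let i≡i′ , j≡j′ = combine-injective i j i′ j′ eq in cong₂ _,_ i≡i′ j≡j′

  chosen⇔ : ∀ e → T (lookup M (edgeIndex e)) ⇔ T (chosen e)
  chosen⇔ e = mk⇔ (subst T (sym (chosen-edgeIndex e))) (subst T (chosen-edgeIndex e))

  IsMatching⇔RingMatching : IsMatching (hexRing ty) M ⇔ RingMatching
  IsMatching⇔RingMatching = mk⇔
    (λ mat e e′ v c c′ e≢e′ at at′ → mat (edgeIndex e) (edgeIndex e′)
       (Equivalence.from (chosen⇔ e) c) (Equivalence.from (chosen⇔ e′) c′) (e≢e′ ∘ edgeIndex-injective)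
       (Equivalence.from (adjacent⇔ e e′) (v , at , at′)))
    (λ mat → every-edgeIndex λ e → every-edgeIndex λ e′ c c′ e≢e′ adj →
       let v , at , at′ = Equivalence.to (adjacent⇔ e e′) adj in
       mat e e′ v (Equivalence.to (chosen⇔ e) c) (Equivalence.to (chosen⇔ e′) c′) (e≢e′ ∘ cong edgeIndex) at at′)

  IsDominating⇔RingDominating : IsDominating (hexRing ty) M ⇔ RingDominating
  IsDominating⇔RingDominating = mk⇔ to from
    where
    to : IsDominating (hexRing ty) M → RingDominating
    to dom e ¬c with dom (edgeIndex e) (¬c ∘ Equivalence.to (chosen⇔ e))
    ... | f , cf , adj =
      let e′ = remQuot {n} 5 f ; f≡e′ = sym (combine-remQuot {n} 5 f)
          v , at , at′ = Equivalence.to (adjacent⇔ e e′) (subst (Adjacent (hexRing ty) (edgeIndex e)) f≡e′ adj)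
      in v , at , e′ , Equivalence.to (chosen⇔ e′) (subst (T ∘ lookup M) f≡e′ cf) , at′
    from : RingDominating → IsDominating (hexRing ty) M
    from dom = every-edgeIndex λ e ¬c →
      let v , at , e′ , c′ , at′ = dom e (¬c ∘ Equivalence.from (chosen⇔ e)) in
      edgeIndex e′ , Equivalence.from (chosen⇔ e′) c′ , Equivalence.from (adjacent⇔ e e′) (v , at , at′)

  uLeftAt uRightAt wLeftAt wRightAt sharedAt : Fin n → Bool
  uLeftAt i  = ownCovered (blk (predMod i)) (k-1Fin (type (predMod i)))
  uRightAt i = lookup (blk i) 0F
  wLeftAt i  = ownCovered (blk (predMod i)) (kFin (type (predMod i)))
  wRightAt i = lookup (blk i) 4F
  sharedAt i = lookup (blk (predMod i)) (sharedEdge (type (predMod i)))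

  edgeDominatedAt : Fin n → Fin 5 → Bool
  edgeDominatedAt i = edgeDominated (type i) (uLeftAt i) (wLeftAt i) (uRightAt (sucMod i)) (wRightAt (sucMod i)) (blk i)

  dominatedAt : Fin n → Bool
  dominatedAt i = all (edgeDominatedAt i) (allFin 5)

  LocalConditions : Set
  LocalConditions = ∀ i → T (validFlags (uLeftAt i) (uRightAt i) (wLeftAt i) (wRightAt i) (sharedAt i))
                        × T (ownMatching (blk i)) × T (dominatedAt i)

  -- Indexed by Fin (suc (2 + m)) rather than Fin n to match the chain lemmas at k = 2 + m syntactically.
  ρ : Fin (suc (2 + m)) → Attach × Block
  ρ i = type i , blk i

  uLeftAt-sucMod : ∀ i → uLeftAt (sucMod i) ≡ ownCovered (blk i) (k-1Fin (type i))
  uLeftAt-sucMod i = cong (λ p → ownCovered (blk p) (k-1Fin (type p))) (predMod-sucMod i)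

  wLeftAt-sucMod : ∀ i → wLeftAt (sucMod i) ≡ ownCovered (blk i) (kFin (type i))
  wLeftAt-sucMod i = cong (λ p → ownCovered (blk p) (kFin (type p))) (predMod-sucMod i)

  sharedAt-sucMod : ∀ i → sharedAt (sucMod i) ≡ lookup (blk i) (sharedEdge (type i))
  sharedAt-sucMod i = cong (λ p → lookup (blk p) (sharedEdge (type p))) (predMod-sucMod i)

  compatibleEverywhere⇔local :
    (∀ i → T (compatible (type i) (cyclicState ρ i) (blk i) (cyclicState ρ (sucMod i)))) ⇔ LocalConditions
  compatibleEverywhere⇔local = mk⇔ to from
    where
    D = cyclicState ρ

    dominated-cong : ∀ t b {uL wL uR wR uL′ wL′ uR′ wR′} → uL ≡ uL′ → wL ≡ wL′ → uR ≡ uR′ → wR ≡ wR′ →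
               T (all (edgeDominated t uL wL uR wR b) (allFin 5)) → T (all (edgeDominated t uL′ wL′ uR′ wR′ b) (allFin 5))
    dominated-cong t b refl refl refl refl d = d

    to : (∀ i → T (compatible (type i) (D i) (blk i) (D (sucMod i)))) → LocalConditions
    to h i = hasFlags⇒validFlags flags , own , dominated-cong (type i) (blk i) (HasFlags.uLeft≡ flags) (HasFlags.wLeft≡ flags)
                                          (Compatible.uRight-in (c (sucMod i))) (Compatible.wRight-in (c (sucMod i))) dominated
      where
      c : ∀ i → Compatible (type i) (D i) (blk i) (D (sucMod i))
      c i = Equivalence.to (T-compatible (type i) (D i) (blk i) (D (sucMod i))) (h i)
      open Compatible (c i)
      c⁻ = c (predMod i)
      from-left : ∀ {F : State → Bool} {r} → F (D (sucMod (predMod i))) ≡ r → F (D i) ≡ r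
      from-left {F} = subst (λ j → F (D j) ≡ _) (sucMod-predMod i)
      flags : HasFlags (D i) (uLeftAt i) (uRightAt i) (wLeftAt i) (wRightAt i) (sharedAt i)
      flags = hasFlags (from-left {uLeft} (Compatible.uLeft-out c⁻)) uRight-in (from-left {wLeft} (Compatible.wLeft-out c⁻)) wRight-in
                       (from-left {sharedChosen} (Compatible.shared-out c⁻))

    from : LocalConditions → ∀ i → T (compatible (type i) (D i) (blk i) (D (sucMod i)))
    from lc i = Equivalence.from (T-compatible (type i) (D i) (blk i) (D (sucMod i))) record
      { uRight-in  = HasFlags.uRight≡ (flags i)
      ; wRight-in  = HasFlags.wRight≡ (flags i)
      ; uLeft-out  = trans (HasFlags.uLeft≡ (flags (sucMod i))) (uLeftAt-sucMod i)
      ; wLeft-out  = trans (HasFlags.wLeft≡ (flags (sucMod i))) (wLeftAt-sucMod i)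
      ; shared-out = trans (HasFlags.shared≡ (flags (sucMod i))) (sharedAt-sucMod i)
      ; own        = proj₁ (proj₂ (lc i))
      ; dominated  = dominated-cong (type i) (blk i) (sym (HasFlags.uLeft≡ (flags i))) (sym (HasFlags.wLeft≡ (flags i)))
                              (sym (HasFlags.uRight≡ (flags (sucMod i)))) (sym (HasFlags.wRight≡ (flags (sucMod i))))
                              (proj₂ (proj₂ (lc i)))
      }
      where
      flags : ∀ j → HasFlags (D j) (uLeftAt j) (uRightAt j) (wLeftAt j) (wRightAt j) (sharedAt j)
      flags j = state-hasFlags _ _ _ _ _ (proj₁ (lc j))

  data OwnEnd (x : Fin 4) : Fin 5 → Set where
    left  : OwnEnd x (inject₁ x)
    right : OwnEnd x (suc x)

  data Incident : Vertex → Edge → Set where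
    own    : ∀ {a x j} → OwnEnd x j → Incident (a , x) (a , j)
    next-u : ∀ {a x} → x ≡ k-1Fin (type a) → Incident (a , x) (sucMod a , 0F)
    next-w : ∀ {a x} → x ≡ kFin (type a) → Incident (a , x) (sucMod a , 4F)

  At→Incident : ∀ v e → v At e → Incident v e
  At→Incident _ (i , 0F) (inj₁ refl) =
    subst (λ j → Incident (predMod i , k-1Fin (type (predMod i))) (j , 0F)) (sucMod-predMod i) (next-u refl)
  At→Incident _ (i , 0F) (inj₂ refl) = own left
  At→Incident _ (i , 1F) (inj₁ refl) = own right
  At→Incident _ (i , 1F) (inj₂ refl) = own left
  At→Incident _ (i , 2F) (inj₁ refl) = own right
  At→Incident _ (i , 2F) (inj₂ refl) = own left
  At→Incident _ (i , 3F) (inj₁ refl) = own right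
  At→Incident _ (i , 3F) (inj₂ refl) = own left
  At→Incident _ (i , 4F) (inj₁ refl) = own right
  At→Incident _ (i , 4F) (inj₂ refl) =
    subst (λ j → Incident (predMod i , kFin (type (predMod i))) (j , 4F)) (sucMod-predMod i) (next-w refl)

  Incident→At : ∀ {v e} → Incident v e → v At e
  Incident→At (own o)              = own-At o
    where own-At : ∀ {a x j} → OwnEnd x j → (a , x) At (a , j)
          own-At {x = 0F} left  = inj₂ refl
          own-At {x = 1F} left  = inj₂ refl
          own-At {x = 2F} left  = inj₂ refl
          own-At {x = 3F} left  = inj₂ refl
          own-At {x = 0F} right = inj₁ refl
          own-At {x = 1F} right = inj₁ refl
          own-At {x = 2F} right = inj₁ refl
          own-At {x = 3F} right = inj₁ refl
  Incident→At {a , _} (next-u refl) = inj₁ (cong (λ p → p , k-1Fin (type p)) (sym (predMod-sucMod a)))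
  Incident→At {a , _} (next-w refl) = inj₂ (cong (λ p → p , kFin (type p)) (sym (predMod-sucMod a)))

  ownCovered-chosen : ∀ {a x j} → OwnEnd x j → T (chosen (a , j)) → T (ownCovered (blk a) x)
  ownCovered-chosen left  c = Equivalence.from T-∨ (inj₁ c)
  ownCovered-chosen right c = Equivalence.from T-∨ (inj₂ c)

  covered : Vertex → Bool
  covered (a , x) = vertexCovered (type a) (uRightAt (sucMod a)) (wRightAt (sucMod a)) (blk a) x

  T-covered : ∀ v → T (covered v) ⇔ (∃ λ e → T (chosen e) × Incident v e)
  T-covered (a , x) = mk⇔ to from
    where
    to : T (covered (a , x)) → ∃ λ e → T (chosen e) × Incident (a , x) e
    to h with Equivalence.to (T-∨ {ownCovered (blk a) x}) h
    ... | inj₁ o with Equivalence.to (T-∨ {lookup (blk a) (inject₁ x)}) o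
    ... | inj₁ c = (a , inject₁ x) , c , own left
    ... | inj₂ c = (a , suc x) , c , own right
    to h | inj₂ h′ with Equivalence.to (T-∨ {⌊ x ≟ k-1Fin (type a) ⌋ ∧ uRightAt (sucMod a)}) h′
    ... | inj₁ u = let x≡ , c = Equivalence.to (T-∧ {⌊ x ≟ k-1Fin (type a) ⌋}) u in (sucMod a , 0F) , c , next-u (toWitness x≡)
    ... | inj₂ w = let x≡ , c = Equivalence.to (T-∧ {⌊ x ≟ kFin (type a) ⌋}) w in (sucMod a , 4F) , c , next-w (toWitness x≡)
    from : (∃ λ e → T (chosen e) × Incident (a , x) e) → T (covered (a , x))
    from (_ , c , own o) = Equivalence.from (T-∨ {ownCovered (blk a) x}) (inj₁ (ownCovered-chosen {a} o c))
    from (_ , c , next-u x≡) = Equivalence.from (T-∨ {ownCovered (blk a) x}) (inj₂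
      (Equivalence.from (T-∨ {⌊ x ≟ k-1Fin (type a) ⌋ ∧ uRightAt (sucMod a)})
        (inj₁ (Equivalence.from (T-∧ {⌊ x ≟ k-1Fin (type a) ⌋}) (fromWitness x≡ , c)))))
    from (_ , c , next-w x≡) = Equivalence.from (T-∨ {ownCovered (blk a) x}) (inj₂
      (Equivalence.from (T-∨ {⌊ x ≟ k-1Fin (type a) ⌋ ∧ _})
        (inj₂ (Equivalence.from (T-∧ {⌊ x ≟ kFin (type a) ⌋}) (fromWitness x≡ , c)))))

  InterfacesMatched : Set
  InterfacesMatched = ∀ i → ¬ (T (uLeftAt i) × T (uRightAt i)) × ¬ (T (wLeftAt i) × T (wRightAt i))

  RingMatching⇒ownMatching : RingMatching → ∀ i → T (ownMatching (blk i))
  RingMatching⇒ownMatching mat i = Equivalence.from (T-all-allFin _) λ x → Equivalence.from T-not λ both →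
    let c , c′ = Equivalence.to (T-∧ {lookup (blk i) (inject₁ x)}) both in
    mat (i , inject₁ x) (i , suc x) (i , x) c c′ (inject₁≢suc x ∘ cong proj₂) (Incident→At (own left)) (Incident→At (own right))

  RingMatching⇒InterfacesMatched : RingMatching → InterfacesMatched
  RingMatching⇒InterfacesMatched mat i =
    (λ (uL , uR) → let e , c , e∈p , at = owner _ _ uL in
      mat e (i , 0F) _ c uR (λ e≡ → predMod≢ i (trans (sym e∈p) (cong proj₁ e≡))) at (inj₁ refl)) ,
    (λ (wL , wR) → let e , c , e∈p , at = owner _ _ wL in
      mat e (i , 4F) _ c wR (λ e≡ → predMod≢ i (trans (sym e∈p) (cong proj₁ e≡))) at (inj₂ refl))
    where
    owner : ∀ a x → T (ownCovered (blk a) x) → ∃ λ e → T (chosen e) × proj₁ e ≡ a × (a , x) At e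
    owner a x h with Equivalence.to (T-∨ {lookup (blk a) (inject₁ x)}) h
    ... | inj₁ c = (a , inject₁ x) , c , refl , Incident→At (own left)
    ... | inj₂ c = (a , suc x) , c , refl , Incident→At (own right)

  own×interfaces⇒RingMatching : (∀ i → T (ownMatching (blk i))) → InterfacesMatched → RingMatching
  own×interfaces⇒RingMatching o im e e′ v c c′ e≢e′ at at′ =
    conflict (At→Incident v e at) (At→Incident v e′ at′) c c′ e≢e′
    where
    own-pair : ∀ {a} x → T (lookup (blk a) (inject₁ x)) → T (lookup (blk a) (suc x)) → ⊥
    own-pair {a} x c c′ = Equivalence.to T-not
      (Equivalence.to (T-all-allFin (λ x → not (lookup (blk a) (inject₁ x) ∧ lookup (blk a) (suc x)))) (o a) x)
      (Equivalence.from (T-∧ {lookup (blk a) (inject₁ x)}) (c , c′))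
    u-pair : ∀ {a} → T (ownCovered (blk a) (k-1Fin (type a))) → T (uRightAt (sucMod a)) → ⊥
    u-pair {a} uL uR = proj₁ (im (sucMod a)) (subst T (sym (uLeftAt-sucMod a)) uL , uR)
    w-pair : ∀ {a} → T (ownCovered (blk a) (kFin (type a))) → T (wRightAt (sucMod a)) → ⊥
    w-pair {a} wL wR = proj₂ (im (sucMod a)) (subst T (sym (wLeftAt-sucMod a)) wL , wR)
    conflict : ∀ {v e e′} → Incident v e → Incident v e′ → T (chosen e) → T (chosen e′) → e ≢ e′ → ⊥
    conflict (own left)           (own left)     c c′ e≢e′ = e≢e′ refl
    conflict (own right)          (own right)    c c′ e≢e′ = e≢e′ refl
    conflict (own {a} {x} left)   (own right)    c c′ e≢e′ = own-pair {a} x c c′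
    conflict (own {a} {x} right)  (own left)     c c′ e≢e′ = own-pair {a} x c′ c
    conflict (own {a} o)          (next-u refl)  c c′ e≢e′ = u-pair (ownCovered-chosen {a} o c) c′
    conflict (next-u refl)        (own {a} o)    c c′ e≢e′ = u-pair (ownCovered-chosen {a} o c′) c
    conflict (own {a} o)          (next-w refl)  c c′ e≢e′ = w-pair (ownCovered-chosen {a} o c) c′
    conflict (next-w refl)        (own {a} o)    c c′ e≢e′ = w-pair (ownCovered-chosen {a} o c′) c
    conflict (next-u refl)        (next-u _)     c c′ e≢e′ = e≢e′ refl
    conflict (next-w refl)        (next-w _)     c c′ e≢e′ = e≢e′ refl
    conflict (next-u refl)        (next-w k-1≡k) c c′ e≢e′ = k-1≢k _ k-1≡k
    conflict (next-w refl)        (next-u k≡k-1) c c′ e≢e′ = k-1≢k _ (sym k≡k-1)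

  RingMatching⇔own×interfaces : RingMatching ⇔ ((∀ i → T (ownMatching (blk i))) × InterfacesMatched)
  RingMatching⇔own×interfaces = mk⇔ (λ mat → RingMatching⇒ownMatching mat , RingMatching⇒InterfacesMatched mat)
                                     (λ (o , im) → own×interfaces⇒RingMatching o im)

  dominatedEdge : Edge → Bool
  dominatedEdge e = chosen e ∨ covered (proj₁ (endpoints e)) ∨ covered (proj₂ (endpoints e))

  RingDominating⇔dominatedEdges : RingDominating ⇔ (∀ e → T (dominatedEdge e))
  RingDominating⇔dominatedEdges = mk⇔ to from
    where
    to : RingDominating → ∀ e → T (dominatedEdge e)
    to dom e with T? (chosen e)
    ... | yes c = Equivalence.from T-∨ (inj₁ c)
    ... | no ¬c with dom e ¬c
    ... | v , at , e′ , c′ , at′ with Equivalence.from (T-covered v) (e′ , c′ , At→Incident v e′ at′) | at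
    ...   | cov | inj₁ refl = Equivalence.from (T-∨ {chosen e}) (inj₂ (Equivalence.from T-∨ (inj₁ cov)))
    ...   | cov | inj₂ refl =
      Equivalence.from (T-∨ {chosen e}) (inj₂ (Equivalence.from (T-∨ {covered (proj₁ (endpoints e))}) (inj₂ cov)))
    from : (∀ e → T (dominatedEdge e)) → RingDominating
    from dom e ¬c with Equivalence.to (T-∨ {chosen e}) (dom e)
    ... | inj₁ c = ⊥-elim (¬c c)
    ... | inj₂ h with Equivalence.to (T-∨ {covered (proj₁ (endpoints e))}) h
    ...   | inj₁ cov = let e′ , c′ , inc = Equivalence.to (T-covered _) cov in _ , inj₁ refl , e′ , c′ , Incident→At inc
    ...   | inj₂ cov = let e′ , c′ , inc = Equivalence.to (T-covered _) cov in _ , inj₂ refl , e′ , c′ , Incident→At inc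

  dominatedEdge≡ : ∀ i j → dominatedEdge (i , j) ≡ edgeDominatedAt i j
  dominatedEdge≡ i 0F = begin
    a ∨ covered (p , k-1Fin (type p)) ∨ c  ≡⟨ cong (λ u → a ∨ u ∨ c) (vertexCovered-k-1 (type p) _ _ (blk p)) ⟩
    a ∨ (uLeftAt i ∨ uRightAt (sucMod p)) ∨ c ≡⟨ cong (λ j → a ∨ (uLeftAt i ∨ uRightAt j) ∨ c) (sucMod-predMod i) ⟩
    a ∨ (uLeftAt i ∨ a) ∨ c                  ≡⟨ absorb a (uLeftAt i) c ⟩
    a ∨ uLeftAt i ∨ c                        ∎
    where open ≡-Reasoning
          p = predMod i
          a = chosen (i , 0F)
          c = covered (i , 0F)
          absorb : ∀ a u c → a ∨ (u ∨ a) ∨ c ≡ a ∨ u ∨ c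
          absorb true  u c = refl
          absorb false u c = cong (_∨ c) (Bool.∨-identityʳ u)
  dominatedEdge≡ i 1F = refl
  dominatedEdge≡ i 2F = refl
  dominatedEdge≡ i 3F = refl
  dominatedEdge≡ i 4F = begin
    a ∨ c ∨ covered (p , kFin (type p))       ≡⟨ cong (λ w → a ∨ c ∨ w) (vertexCovered-k (type p) _ _ (blk p)) ⟩
    a ∨ c ∨ (wLeftAt i ∨ wRightAt (sucMod p)) ≡⟨ cong (λ j → a ∨ c ∨ (wLeftAt i ∨ wRightAt j)) (sucMod-predMod i) ⟩
    a ∨ c ∨ (wLeftAt i ∨ a)                   ≡⟨ absorb a c (wLeftAt i) ⟩
    a ∨ c ∨ wLeftAt i                         ∎
    where open ≡-Reasoning
          p = predMod i
          a = chosen (i , 4F)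
          c = covered (i , 3F)
          absorb : ∀ a c w → a ∨ c ∨ (w ∨ a) ≡ a ∨ c ∨ w
          absorb true  c w = refl
          absorb false c w = cong (c ∨_) (Bool.∨-identityʳ w)

  dominatedEdges⇔dominatedAt : (∀ e → T (dominatedEdge e)) ⇔ (∀ i → T (dominatedAt i))
  dominatedEdges⇔dominatedAt = mk⇔
    (λ h i → Equivalence.from (T-all-allFin _) λ j → subst T (dominatedEdge≡ i j) (h (i , j)))
    (λ h (i , j) → subst T (sym (dominatedEdge≡ i j)) (Equivalence.to (T-all-allFin (edgeDominatedAt i)) (h i) j))

  sharedEdge-endpoints : ∀ p → endpoints (p , sharedEdge (type p)) ≡ ((p , k-1Fin (type p)) , (p , kFin (type p)))
  sharedEdge-endpoints p with type p
  ... | t1 = refl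
  ... | t2 = refl
  ... | t3 = refl

  edgeDominatedAt-sharedEdge : ∀ i → let p = predMod i ; s = sharedEdge (type p) in
    edgeDominatedAt p s ≡ chosen (p , s) ∨ (uLeftAt i ∨ uRightAt i) ∨ (wLeftAt i ∨ wRightAt i)
  edgeDominatedAt-sharedEdge i = begin
    edgeDominatedAt p s
      ≡⟨ dominatedEdge≡ p s ⟨
    chosen (p , s) ∨ covered (proj₁ (endpoints (p , s))) ∨ covered (proj₂ (endpoints (p , s)))
      ≡⟨ cong (λ ends → chosen (p , s) ∨ covered (proj₁ ends) ∨ covered (proj₂ ends)) (sharedEdge-endpoints p) ⟩
    chosen (p , s) ∨ covered (p , k-1Fin (type p)) ∨ covered (p , kFin (type p))
      ≡⟨ cong₂ (λ u w → chosen (p , s) ∨ u ∨ w) (vertexCovered-k-1 (type p) _ _ (blk p)) (vertexCovered-k (type p) _ _ (blk p)) ⟩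
    chosen (p , s) ∨ (uLeftAt i ∨ uRightAt (sucMod p)) ∨ (wLeftAt i ∨ wRightAt (sucMod p))
      ≡⟨ cong (λ j → chosen (p , s) ∨ (uLeftAt i ∨ uRightAt j) ∨ (wLeftAt i ∨ wRightAt j)) (sucMod-predMod i) ⟩
    chosen (p , s) ∨ (uLeftAt i ∨ uRightAt i) ∨ (wLeftAt i ∨ wRightAt i)
      ∎
    where open ≡-Reasoning
          p = predMod i
          s = sharedEdge (type p)

  dominated⇒someFlag : ∀ i → T (dominatedAt (predMod i)) → T (uLeftAt i ∨ uRightAt i ∨ wLeftAt i ∨ wRightAt i)
  dominated⇒someFlag i d with Equivalence.to (T-∨ {chosen (p , s)})
                                (subst T (edgeDominatedAt-sharedEdge i) (Equivalence.to (T-all-allFin (edgeDominatedAt p)) d s))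
    where p = predMod i
          s = sharedEdge (type p)
  ... | inj₁ c = Equivalence.from T-∨ (inj₁
    (Equivalence.from (T-∨ {lookup (blk (predMod i)) (inject₁ (k-1Fin (type (predMod i))))}) (inj₂ c)))
  ... | inj₂ h = subst T (Bool.∨-assoc (uLeftAt i) (uRightAt i) _) h

  sharedAt⇒leftFlags : ∀ i → T (sharedAt i) → T (uLeftAt i ∧ wLeftAt i)
  sharedAt⇒leftFlags i e = Equivalence.from (T-∧ {uLeftAt i})
    ( Equivalence.from (T-∨ {lookup (blk p) (inject₁ (k-1Fin (type p)))}) (inj₂ e)
    , Equivalence.from T-∨ (inj₁ (subst (T ∘ lookup (blk p)) (sharedEdge≡inject₁-k (type p)) e)))
    where p = predMod i
          sharedEdge≡inject₁-k : ∀ t → sharedEdge t ≡ inject₁ (kFin t)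
          sharedEdge≡inject₁-k t1 = refl
          sharedEdge≡inject₁-k t2 = refl
          sharedEdge≡inject₁-k t3 = refl

  RingDominating⇔dominatedAt : RingDominating ⇔ (∀ i → T (dominatedAt i))
  RingDominating⇔dominatedAt = dominatedEdges⇔dominatedAt ⇔-∘ RingDominating⇔dominatedEdges

  matching×dominating⇔local : (RingMatching × RingDominating) ⇔ LocalConditions
  matching×dominating⇔local = mk⇔ to from
    where
    to : RingMatching × RingDominating → LocalConditions
    to (mat , dom) i =
      validFlags-intro {uLeftAt i} {uRightAt i} {wLeftAt i} {wRightAt i} {sharedAt i}
        (proj₁ (im i)) (proj₂ (im i)) (dominated⇒someFlag i (d (predMod i))) (sharedAt⇒leftFlags i) , o i , d i
      where o  = RingMatching⇒ownMatching mat
            im = RingMatching⇒InterfacesMatched mat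
            d  = Equivalence.to RingDominating⇔dominatedAt dom
    from : LocalConditions → RingMatching × RingDominating
    from lc = Equivalence.from RingMatching⇔own×interfaces (proj₁ ∘ proj₂ ∘ lc , interfaces)
            , Equivalence.from RingDominating⇔dominatedAt (proj₂ ∘ proj₂ ∘ lc)
      where interfaces : InterfacesMatched
            interfaces i = validFlags-elim {uLeftAt i} {uRightAt i} {wLeftAt i} {wRightAt i} {sharedAt i} (proj₁ (lc i))

  maximal⇔compatibleEverywhere :
    T (isMaximalMatching (hexRing ty) M) ⇔ (∀ i → T (compatible (type i) (cyclicState ρ i) (blk i) (cyclicState ρ (sucMod i))))
  maximal⇔compatibleEverywhere =
    ⇔-sym compatibleEverywhere⇔local ⇔-∘ (matching×dominating⇔local ⇔-∘
      ((IsMatching⇔RingMatching ×-⇔ IsDominating⇔RingDominating) ⇔-∘ isMaximalMatching⇔matching×dominating (hexRing ty) M))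

  cycleCompatible : Bool
  cycleCompatible = chain (2 + m) ρ (cyclicState ρ zero) (cyclicState ρ zero)

  maximal⇔cycle : T (isMaximalMatching (hexRing ty) M) ⇔ T cycleCompatible
  maximal⇔cycle = ⇔-sym (T-chain-cycle ρ) ⇔-∘ maximal⇔compatibleEverywhere

  -- Stated on its own because the conversion is much cheaper before tr is applied.
  blockProduct≡ : prodM (tabulate (λ i → stepMatrix (ρ i))) ≡ blockProduct blockMatrix ty M
  blockProduct≡ = refl

  maximal-indicator≡trace : indicator (isMaximalMatching (hexRing ty) M) ≡ tr (blockProduct blockMatrix ty M)
  maximal-indicator≡trace =
    trans (cong indicator (T-⇔⇒≡ {isMaximalMatching (hexRing ty) M} {cycleCompatible} maximal⇔cycle))
          (trans (sym (tr-prodM-chain (2 + m) ρ)) (cong tr blockProduct≡))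

theorem1 : (m : ℕ) (ty : Vec Attach (3 + m)) →
    Ψ (hexRing ty) ≡ tr (prodM (map f (toList ty)))
theorem1 m ty = begin
  Ψ (hexRing ty)                                      ≡⟨ length-filterᵇ (isMaximalMatching (hexRing ty)) Ms ⟩
  ∑ Ms (indicator ∘ isMaximalMatching (hexRing ty))   ≡⟨ ∑-cong Ms (Ring.maximal-indicator≡trace m ty) ⟩
  ∑ Ms (λ M → tr (blockProduct blockMatrix ty M))     ≡⟨ tr-∑ᴹ Ms (blockProduct blockMatrix ty) ⟨
  tr (∑ᴹ Ms (blockProduct blockMatrix ty))            ≡⟨ tr-cong (∑-blockProduct blockMatrix ty) ⟩
  tr (prodM (map transfer ts))                        ≡⟨ tr-cong (prodM-map-cong transfer-factorisation ts) ⟩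
  tr (prodM (map (λ t → B t ⊗ X) ts))                 ≡⟨ tr-prodM-rotate X B ts ⟨
  tr (prodM (map (λ t → X ⊗ B t) ts))                 ≡⟨ tr-cong (prodM-map-cong f-factorisation ts) ⟨
  tr (prodM (map f ts))                               ∎
  where
  open ≡-Reasoning
  Ms = allSubsets ((3 + m) * 5)
  ts = toList ty
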